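{- Let $n\ge 1$ and let $\lambda\vdash n$ be a partition written as $\lambda=1^{j_1}2^{j_2}\cdots n^{j_n}$, where $j_i\ge 0$ denotes the number of parts of $\lambda$ equal to $i$. Let $\rho\in S_n$ be any permutation of cycle type $\lambda$, and let $$N(\lambda)=\left|\{(\sigma,\tau)\in S_n\times S_n:\ \sigma^2=\tau^2=1,\ \sigma\tau=\rho\}\right|.$$ Then $$N(\lambda)=\prod_{i=1}^n R_{j_i}(i),$$ where for integers $m\ge 0$ and $k\ge 1$, $$R_m(k)=\sum_{0\le i\le m/2}\frac{k^{m-i}\, m!}{2^i\, i!\,(m-2i)!}.$$
   Context: $S_n$ is the symmetric group on $[n]=\{1,\dots,n\}$; an involution is a permutation whose square is the identity (the identity itself included). The number $N(\lambda)$ does not depend on the choice of $\rho$ within the conjugacy class of cycle type $\lambda$. Note $R_0(k)=1$. -}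

module Defs where

open import Data.Nat using (ℕ; zero; suc; _+_; _*_; _∸_; _^_; _≤_; _<_; _/_; _≟_; _≤?_; _<?_)
open import Data.Nat.Properties using (m*n≢0; m^n≢0; _!≢0)
open import Data.Nat using (_!)
open import Data.Nat.ListAction using (sum; product)
open import Data.Fin using (Fin; toℕ)
import Data.Fin.Properties as FinP
open import Data.Fin.Permutation using (Permutation′; _⟨$⟩ʳ_)
open import Data.List using (List; []; _∷_; map; concatMap; filter; length; upTo; allFin; cartesianProduct)
open import Data.Vec using (Vec; lookup) renaming ([] to []ᵥ; _∷_ to _∷ᵥ_)
open import Data.Product using (_×_; _,_; proj₁; proj₂)
open import Function using (id; _∘_)
open import Relation.Nullary using (Dec; ¬_; ¬?)
open import Relation.Nullary.Decidable using (_×-dec_; _→-dec_)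
open import Relation.Binary.PropositionalEquality using (_≡_; _≢_)

iter : ∀ {n} → (Fin n → Fin n) → ℕ → Fin n → Fin n
iter f zero    x = x
iter f (suc k) x = f (iter f k x)

MinPeriod : ∀ {n} → (Fin n → Fin n) → Fin n → ℕ → Set
MinPeriod f x k =
  (1 ≤ k) × (iter f k x ≡ x) × ((i : Fin k) → 1 ≤ toℕ i → iter f (toℕ i) x ≢ x)

minPeriod? : ∀ {n} (f : Fin n → Fin n) x k → Dec (MinPeriod f x k)
minPeriod? f x k =
  (1 ≤? k) ×-dec ((iter f k x FinP.≟ x)
    ×-dec FinP.all? (λ i → (1 ≤? toℕ i) →-dec ¬? (iter f (toℕ i) x FinP.≟ x)))

pointsInCyclesOfLength : ∀ {n} → Permutation′ n → ℕ → ℕ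
pointsInCyclesOfLength {n} ρ k = length (filter (λ x → minPeriod? (ρ ⟨$⟩ʳ_) x k) (allFin n))

-- ρ has cycle type 1^{j 1} 2^{j 2} ... n^{j n}: for each 1 ≤ i ≤ n, ρ has exactly
-- j i cycles of length i, i.e. exactly i * j i points lie in i-cycles
HasCycleType : ∀ {n} → Permutation′ n → (ℕ → ℕ) → Set
HasCycleType {n} ρ j = ∀ i → 1 ≤ i → i ≤ n → pointsInCyclesOfLength ρ i ≡ i * j i

sum1to : ℕ → (ℕ → ℕ) → ℕ
sum1to n f = sum (map (f ∘ suc) (upTo n))

prod1to : ℕ → (ℕ → ℕ) → ℕ
prod1to n f = product (map (f ∘ suc) (upTo n))

allVecs : ∀ k n → List (Vec (Fin n) k)
allVecs zero    n = []ᵥ ∷ []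
allVecs (suc k) n = concatMap (λ x → map (x ∷ᵥ_) (allVecs k n)) (allFin n)

allFuns : ∀ n → List (Fin n → Fin n)
allFuns n = map lookup (allVecs n n)

_≗ᶠ_ : ∀ {n} → (Fin n → Fin n) → (Fin n → Fin n) → Set
f ≗ᶠ g = ∀ x → f x ≡ g x

_≗ᶠ?_ : ∀ {n} (f g : Fin n → Fin n) → Dec (f ≗ᶠ g)
f ≗ᶠ? g = FinP.all? (λ x → f x FinP.≟ g x)

InvPair : ∀ {n} → Permutation′ n → (Fin n → Fin n) × (Fin n → Fin n) → Set
InvPair ρ (σ , τ) = ((σ ∘ σ) ≗ᶠ id) × ((τ ∘ τ) ≗ᶠ id) × ((σ ∘ τ) ≗ᶠ (ρ ⟨$⟩ʳ_))

invPair? : ∀ {n} (ρ : Permutation′ n) p → Dec (InvPair ρ p)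
invPair? ρ (σ , τ) = ((σ ∘ σ) ≗ᶠ? id) ×-dec (((τ ∘ τ) ≗ᶠ? id) ×-dec ((σ ∘ τ) ≗ᶠ? (ρ ⟨$⟩ʳ_)))

-- N = |{(σ,τ) ∈ S_n × S_n : σ² = τ² = 1, στ = ρ}|
-- (any self-map σ with σ∘σ = id is a permutation, so counting among all self-maps is the same)
N : ∀ {n} → Permutation′ n → ℕ
N {n} ρ = length (filter (invPair? ρ) (cartesianProduct (allFuns n) (allFuns n)))

R : ℕ → ℕ → ℕ
R m k = sum (map term (upTo (suc (m / 2))))
  where
  term : ℕ → ℕ
  term i = (k ^ (m ∸ i) * m !) / (2 ^ i * i ! * (m ∸ 2 * i) !)
    where instance
      _ = m*n≢0 (2 ^ i * i !) ((m ∸ 2 * i) !) {{m*n≢0 (2 ^ i) (i !) {{m^n≢0 2 i}} {{i !≢0}}}} {{(m ∸ 2 * i) !≢0}}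

module Submission where

open import Defs
open import Data.Nat using (ℕ; _≤_; _*_)
open import Data.Nat.Induction using (<-wellFounded)
open import Data.Fin.Permutation using (Permutation′)
open import Relation.Binary.PropositionalEquality using (_≡_; module ≡-Reasoning)

-- Writing f = ρ, the pairs (σ, τ) with σ² = τ² = 1 and στ = f are determined by σ
-- (τ = σ ∘ f), and σ ranges over the involutions with σ f σ = f⁻¹.  More generally,
-- for a region S (a union of cycles of f) let M S count the involutions g that fix
-- every point outside S and satisfy g ∘ f = f⁻¹ ∘ g on S.  Pick x0 ∈ S on a k-cycle C
-- and classify g by y = g x0: y has period k, and g is forced on the cycle(s) of
-- x0 and y (g(f^s x0) = f^(-s) y).  If y ∈ C (k choices) the rest of g is counted
-- by M (S ∖ C); if y lies on one of the other m-1 k-cycles D (k(m-1) choices) it is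
-- counted by M (S ∖ C ∖ D).  So M satisfies the recurrence
--   R_m(k) = k R_{m-1}(k) + (m-1) k R_{m-2}(k),   R_0(k) = 1,
-- of the closed formula, and induction on |S| gives M S = Π_i R_{j_i}(i).

module Counting where

  open import Level using (0ℓ)
  open import Data.Nat.Properties using (≤-antisym)
  open import Data.Fin using (Fin; zero; suc)
  open import Data.Fin.Properties using (injective⇒≤)
  open import Data.List using (List; _∷_; length; filter; lookup)
  open import Data.List.Relation.Unary.All using (All; _∷_)
  open import Data.List.Relation.Unary.All.Properties using (all-filter)
  open import Data.List.Relation.Unary.AllPairs using (_∷_)
  open import Data.List.Relation.Unary.Any as Any using (Any)
  open import Data.List.Relation.Unary.Any.Properties using (lookup-index)
  open import Data.List.Membership.Setoid.Properties using (∈-filter⁺)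
  open import Data.List.Relation.Unary.Unique.Setoid using (Unique)
  import Data.List.Relation.Unary.Unique.Setoid.Properties as Unique
  import Data.List.Membership.Setoid as Membership
  open import Data.Empty using (⊥-elim)
  open import Relation.Unary using (Pred; Decidable)
  open import Relation.Binary.Bundles using (Setoid)
  open import Relation.Binary.PropositionalEquality using (refl; cong; sym; subst)

  Complete : (A : Setoid 0ℓ 0ℓ) → List (Setoid.Carrier A) → Set
  Complete A xs = ∀ a → Membership._∈_ A a xs

  private
    lookup-all : ∀ {A : Set} {P : Pred A 0ℓ} {xs} → All P xs → (i : Fin (length xs)) → P (lookup xs i)
    lookup-all (px ∷ _)   zero    = px
    lookup-all (_  ∷ pxs) (suc i) = lookup-all pxs i

  lookup-injective : (A : Setoid 0ℓ 0ℓ) → let open Setoid A in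
    ∀ {xs} → Unique A xs → ∀ i j → lookup xs i ≈ lookup xs j → i ≡ j
  lookup-injective A (_  ∷ _)   zero    zero    _ = refl
  lookup-injective A (px ∷ _)   zero    (suc j) e = ⊥-elim (lookup-all px j e)
  lookup-injective A (px ∷ _)   (suc i) zero    e = ⊥-elim (lookup-all px i (Setoid.sym A e))
  lookup-injective A (_  ∷ pxs) (suc i) (suc j) e = cong suc (lookup-injective A pxs i j e)

  record Embedding (A B : Setoid 0ℓ 0ℓ) (P : Pred (Setoid.Carrier A) 0ℓ)
                   (Q : Pred (Setoid.Carrier B) 0ℓ) : Set where
    field
      map       : ∀ a → P a → Setoid.Carrier B
      into      : ∀ a p → Q (map a p)
      injective : ∀ a b p q → Setoid._≈_ B (map a p) (map b q) → Setoid._≈_ A a b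

  module _ (A B : Setoid 0ℓ 0ℓ) where
    open Setoid A using () renaming (Carrier to CA)
    open Setoid B using () renaming (Carrier to CB; _≈_ to _≈B_; sym to symB; trans to transB)

    count-≤ : {P : Pred CA 0ℓ} {Q : Pred CB 0ℓ} (P? : Decidable P) (Q? : Decidable Q) →
      (∀ {a b} → a ≈B b → Q a → Q b) →
      ∀ {xs ys} → Unique A xs → Complete B ys → Embedding A B P Q →
      length (filter P? xs) ≤ length (filter Q? ys)
    count-≤ P? Q? respQ {xs} {ys} uxs cys emb = injective⇒≤ {f = position} position-injective
      where
      open Embedding emb
      us : List CA
      us = filter P? xs
      -- the i-th element of `us` is sent to the position of its image in `filter Q? ys`
      image : Fin (length us) → CB
      image i = map (lookup us i) (lookup-all (all-filter P? xs) i)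
      found : ∀ i → Any (image i ≈B_) (filter Q? ys)
      found i = ∈-filter⁺ B Q? respQ (cys (image i)) (into _ _)
      position : Fin (length us) → Fin (length (filter Q? ys))
      position i = Any.index (found i)
      position-injective : ∀ {i j} → position i ≡ position j → i ≡ j
      position-injective {i} {j} e = lookup-injective A (Unique.filter⁺ A P? uxs) i j
        (injective _ _ _ _ (transB (lookup-index (found i))
          (symB (subst (λ p → image j ≈B lookup (filter Q? ys) p) (sym e)
                   (lookup-index (found j))))))

  count-≡ : (A B : Setoid 0ℓ 0ℓ) {P : Pred (Setoid.Carrier A) 0ℓ} {Q : Pred (Setoid.Carrier B) 0ℓ}
    (P? : Decidable P) (Q? : Decidable Q) →
    (∀ {a b} → Setoid._≈_ A a b → P a → P b) → (∀ {a b} → Setoid._≈_ B a b → Q a → Q b) →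
    ∀ {xs ys} → Unique A xs → Complete A xs → Unique B ys → Complete B ys →
    Embedding A B P Q → Embedding B A Q P →
    length (filter P? xs) ≡ length (filter Q? ys)
  count-≡ A B P? Q? respP respQ uxs cxs uys cys φ ψ =
    ≤-antisym (count-≤ A B P? Q? respQ uxs cys φ) (count-≤ B A Q? P? respP uys cxs ψ)

module Enumeration where

  open import Level using (0ℓ)
  open import Data.Nat using (zero; suc)
  open import Data.Fin using (Fin)
  open import Data.List using (List; []; _∷_; map; concatMap; allFin; cartesianProduct; cartesianProductWith; _++_)
  open import Data.Vec using (Vec; lookup; tabulate) renaming ([] to []ᵥ; _∷_ to _∷ᵥ_)
  open import Data.Vec.Properties using (tabulate∘lookup; tabulate-cong; lookup∘tabulate; ∷-injective)
  open import Data.List.Relation.Unary.All using ([])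
  open import Data.List.Relation.Unary.AllPairs using ([]; _∷_)
  open import Data.List.Relation.Unary.Any as Any using (here)
  import Data.List.Relation.Unary.Any.Properties as Any
  open import Data.List.Relation.Unary.Unique.Setoid using (Unique)
  import Data.List.Relation.Unary.Unique.Setoid.Properties as Unique
  open import Data.List.Relation.Unary.Unique.Propositional.Properties using (allFin⁺)
  open import Data.List.Membership.Propositional.Properties using (∈-allFin)
  open import Data.Product using (_,_)
  open import Data.Product.Relation.Binary.Pointwise.NonDependent using (_×ₛ_)
  open import Relation.Binary.Bundles using (Setoid)
  open import Relation.Binary.PropositionalEquality as ≡ using (refl; cong; sym; trans; _→-setoid_)
  open Counting using (Complete)

  FinS : ℕ → Setoid 0ℓ 0ℓ
  FinS n = ≡.setoid (Fin n)

  Maps : ℕ → Setoid 0ℓ 0ℓ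
  Maps n = Fin n →-setoid Fin n

  allFin-unique : ∀ n → Unique (FinS n) (allFin n)
  allFin-unique = allFin⁺

  allFin-complete : ∀ n → Complete (FinS n) (allFin n)
  allFin-complete n = ∈-allFin

  private
    allVecs-step : ∀ {k n} (xs : List (Fin n)) (vs : List (Vec (Fin n) k)) →
      concatMap (λ x → map (x ∷ᵥ_) vs) xs ≡ cartesianProductWith _∷ᵥ_ xs vs
    allVecs-step []       vs = refl
    allVecs-step (x ∷ xs) vs = cong (map (x ∷ᵥ_) vs ++_) (allVecs-step xs vs)

    allVecs-unique : ∀ k n → Unique (≡.setoid _) (allVecs k n)
    allVecs-unique zero    n = [] ∷ []
    allVecs-unique (suc k) n rewrite allVecs-step (allFin n) (allVecs k n) =
      Unique.cartesianProductWith⁺ (FinS n) (≡.setoid _) (≡.setoid _) _∷ᵥ_ ∷-injective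
        (allFin-unique n) (allVecs-unique k n)

    allVecs-complete : ∀ k n → Complete (≡.setoid (Vec (Fin n) k)) (allVecs k n)
    allVecs-complete zero    n []ᵥ       = here refl
    allVecs-complete (suc k) n (x ∷ᵥ v) rewrite allVecs-step (allFin n) (allVecs k n) =
      Any.cartesianProductWith⁺ _∷ᵥ_ (λ { refl refl → refl }) (∈-allFin x) (allVecs-complete k n v)

    lookup-injective : ∀ {k n} (v w : Vec (Fin n) k) → (∀ x → lookup v x ≡ lookup w x) → v ≡ w
    lookup-injective v w e = trans (sym (tabulate∘lookup v)) (trans (tabulate-cong e) (tabulate∘lookup w))

  allFuns-unique : ∀ n → Unique (Maps n) (allFuns n)
  allFuns-unique n = Unique.map⁺ (≡.setoid _) (Maps n) (lookup-injective _ _) (allVecs-unique n n)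

  allFuns-complete : ∀ n → Complete (Maps n) (allFuns n)
  allFuns-complete n f = Any.map⁺ (Any.map (λ { refl x → sym (lookup∘tabulate f x) })
                                           (allVecs-complete n n (tabulate f)))

  pairs-unique : ∀ n → Unique (Maps n ×ₛ Maps n) (cartesianProduct (allFuns n) (allFuns n))
  pairs-unique n = Unique.cartesianProduct⁺ (Maps n) (Maps n) (allFuns-unique n) (allFuns-unique n)

  pairs-complete : ∀ n → Complete (Maps n ×ₛ Maps n) (cartesianProduct (allFuns n) (allFuns n))
  pairs-complete n (f , g) = Any.cartesianProductWith⁺ _,_ _,_ (allFuns-complete n f) (allFuns-complete n g)

module Counts where

  open import Level using (0ℓ)
  open import Data.Nat using (suc; _+_; _<_)
  open import Data.Nat.Properties using (+-suc; *-distribʳ-+)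
  open import Data.Nat.Tactic.RingSolver using (solve-∀)
  open import Data.Bool using (if_then_else_)
  open import Data.Fin using (Fin) renaming (_≟_ to _≟ᶠ_)
  open import Data.List using (List; []; _∷_; length; filter; map; allFin)
  open import Data.List.Properties using (map-cong; filter-≐; filter-none; filter-some)
  open import Data.Nat.ListAction using (sum)
  import Data.List.Relation.Unary.All as All
  open import Data.List.Relation.Unary.AllPairs using ([]; _∷_)
  open import Data.List.Relation.Unary.Any as Any using (Any; here)
  open import Data.Product using (_×_; _,_; proj₁; proj₂)
  open import Data.Unit using (⊤; tt)
  open import Relation.Nullary using (¬_; Dec; yes; no; does)
  open import Relation.Nullary.Decidable using (_×-dec_; ¬?)
  open import Relation.Unary using (Pred; Decidable)
  open import Relation.Binary.PropositionalEquality as ≡ using (refl; cong; cong₂; sym; trans; module ≡-Reasoning)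
  open Counting using (count-≡)
  open Enumeration using (FinS; allFin-unique; allFin-complete)

  count : ∀ {A : Set} {P : Pred A 0ℓ} → Decidable P → List A → ℕ
  count P? xs = length (filter P? xs)

  𝟙 : ∀ {P : Set} → Dec P → ℕ
  𝟙 d = if does d then 1 else 0

  module _ {A : Set} where

    count-∷ : ∀ {P : Pred A 0ℓ} (P? : Decidable P) x xs → count P? (x ∷ xs) ≡ 𝟙 (P? x) + count P? xs
    count-∷ P? x xs with P? x
    ... | yes _ = refl
    ... | no  _ = refl

    count-≐ : ∀ {P Q : Pred A 0ℓ} (P? : Decidable P) (Q? : Decidable Q) →
      (∀ {a} → P a → Q a) → (∀ {a} → Q a → P a) → ∀ xs → count P? xs ≡ count Q? xs
    count-≐ P? Q? pq qp xs = cong length (filter-≐ P? Q? (pq , qp) xs)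

    count-none : ∀ {P : Pred A 0ℓ} (P? : Decidable P) → (∀ a → ¬ P a) → ∀ xs → count P? xs ≡ 0
    count-none P? none xs = cong length (filter-none P? (All.universal none xs))

    count-some : ∀ {P : Pred A 0ℓ} (P? : Decidable P) {x} xs → Any (x ≡_) xs → P x → 0 < count P? xs
    count-some P? xs x∈xs px = filter-some P? (Any.map (λ { refl → px }) x∈xs)

    count-split : ∀ {P Q : Pred A 0ℓ} (P? : Decidable P) (Q? : Decidable Q) → ∀ xs →
      count P? xs ≡ count (λ a → P? a ×-dec Q? a) xs + count (λ a → P? a ×-dec ¬? (Q? a)) xs
    count-split P? Q? [] = refl
    count-split P? Q? (x ∷ xs) with P? x | Q? x
    ... | yes _ | yes _ = cong suc (count-split P? Q? xs)
    ... | yes _ | no  _ = trans (cong suc (count-split P? Q? xs)) (sym (+-suc _ _))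
    ... | no  _ | _     = count-split P? Q? xs

    sum-cong : ∀ {g h : A → ℕ} → (∀ a → g a ≡ h a) → ∀ xs → sum (map g xs) ≡ sum (map h xs)
    sum-cong e xs = cong sum (map-cong e xs)

    sum-+ : ∀ (g h : A → ℕ) xs → sum (map (λ a → g a + h a) xs) ≡ sum (map g xs) + sum (map h xs)
    sum-+ g h []       = refl
    sum-+ g h (x ∷ xs) rewrite sum-+ g h xs = interchange (g x) (h x) _ _
      where
      interchange : ∀ a b c d → a + b + (c + d) ≡ a + c + (b + d)
      interchange = solve-∀

    sum-*ʳ : ∀ c (g : A → ℕ) xs → sum (map (λ a → g a * c) xs) ≡ sum (map g xs) * c
    sum-*ʳ c g []       = refl
    sum-*ʳ c g (x ∷ xs) rewrite sum-*ʳ c g xs = sym (*-distribʳ-+ c (g x) _)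

    sum-𝟙 : ∀ {P : Pred A 0ℓ} (P? : Decidable P) xs → sum (map (λ a → 𝟙 (P? a)) xs) ≡ count P? xs
    sum-𝟙 P? []       = refl
    sum-𝟙 P? (x ∷ xs) = trans (cong (𝟙 (P? x) +_) (sum-𝟙 P? xs)) (sym (count-∷ P? x xs))

  count-singleton : ∀ {n} (c : Fin n) → count (c ≟ᶠ_) (allFin n) ≡ 1
  count-singleton {n} c = count-≡ (FinS n) (≡.setoid ⊤) (c ≟ᶠ_) (λ _ → yes tt)
    (λ { refl p → p }) (λ _ q → q) (allFin-unique n) (allFin-complete n) (All.[] ∷ []) (λ _ → here refl)
    (record { map = λ _ _ → tt ; into = λ _ _ → tt ; injective = λ a b p q _ → trans (sym p) q })
    (record { map = λ _ _ → c ; into = λ _ _ → refl ; injective = λ _ _ _ _ _ → refl })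

  count-by-fibres : ∀ {A : Set} {n} {P : Pred A 0ℓ} (P? : Decidable P) (h : A → Fin n) xs →
    count P? xs ≡ sum (map (λ y → count (λ a → P? a ×-dec (h a ≟ᶠ y)) xs) (allFin n))
  count-by-fibres {n = n} P? h [] = sym (sum-zero (allFin n))
    where
    sum-zero : ∀ ys → sum (map (λ (_ : Fin n) → 0) ys) ≡ 0
    sum-zero []       = refl
    sum-zero (_ ∷ ys) = sum-zero ys
  count-by-fibres {n = n} {P} P? h (x ∷ xs) = sym (begin
      sum (map (λ y → count (fibre y) (x ∷ xs)) (allFin n))
        ≡⟨ sum-cong (λ y → count-∷ (fibre y) x xs) (allFin n) ⟩
      sum (map (λ y → 𝟙 (fibre y x) + count (fibre y) xs) (allFin n))
        ≡⟨ sum-+ (λ y → 𝟙 (fibre y x)) (λ y → count (fibre y) xs) (allFin n) ⟩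
      sum (map (λ y → 𝟙 (fibre y x)) (allFin n)) + sum (map (λ y → count (fibre y) xs) (allFin n))
        ≡⟨ cong₂ _+_ (trans (sum-𝟙 (λ y → fibre y x) (allFin n)) (head-fibre (P? x)))
                     (sym (count-by-fibres P? h xs)) ⟩
      𝟙 (P? x) + count P? xs
        ≡⟨ sym (count-∷ P? x xs) ⟩
      count P? (x ∷ xs) ∎)
    where
    open ≡-Reasoning
    fibre : ∀ y a → Dec (P a × h a ≡ y)
    fibre y a = P? a ×-dec (h a ≟ᶠ y)
    -- `x` lies in exactly one fibre, and is counted there iff `P x`
    head-fibre : ∀ {X : Set} (d : Dec X) → count (λ y → d ×-dec (h x ≟ᶠ y)) (allFin n) ≡ 𝟙 d
    head-fibre (yes p) = trans (count-≐ _ (h x ≟ᶠ_) proj₂ (p ,_) (allFin n)) (count-singleton (h x))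
    head-fibre (no ¬p) = count-none _ (λ _ q → ¬p (proj₁ q)) (allFin n)

-- The summand of `R` is  k^(m-i) · pairings m i, where `pairings m i` (the number
-- of ways to choose i disjoint pairs among m points) obeys Pascal's rule
--   pairings (m+2) (i+1) = pairings (m+1) (i+1) + (m+1) · pairings m i
-- (the first point is unpaired, or paired with one of the m+1 others); the
-- recurrence for `R` is the same rule summed against powers of k.
module Arithmetic where

  open import Data.Nat
  open import Data.Nat.Properties
  open import Data.Nat.DivMod using (m*n/n≡m; m≡m%n+[m/n]*n; m%n<n; m/n*n≤m; m/n≤m)
  open import Data.Nat.Tactic.RingSolver using (solve-∀)
  open import Data.List using (applyUpTo)
  open import Data.List.Properties using (map-applyUpTo)
  open import Data.Nat.ListAction using (sum)
  open import Relation.Binary.PropositionalEquality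
  open import Function using (_∘_; id)

  pairings : ℕ → ℕ → ℕ
  pairings m             zero    = 1
  pairings zero          (suc i) = 0
  pairings (suc zero)    (suc i) = 0
  pairings (suc (suc m)) (suc i) = pairings (suc m) (suc i) + suc m * pairings m i

  private
    double-suc : ∀ i → 2 * suc i ≡ 2 + 2 * i
    double-suc = solve-∀

  -- there are no i disjoint pairs among fewer than 2i points
  pairings-vanish : ∀ m i → m < 2 * i → pairings m i ≡ 0
  pairings-vanish m             zero    ()
  pairings-vanish zero          (suc i) _ = refl
  pairings-vanish (suc zero)    (suc i) _ = refl
  pairings-vanish (suc (suc m)) (suc i) m+2<2i+2
    rewrite pairings-vanish (suc m) (suc i) (<-trans (n<1+n _) m+2<2i+2)
          | pairings-vanish m i (≤-pred (≤-pred (subst (3 + m ≤_) (double-suc i) m+2<2i+2)))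
    = *-zeroʳ (suc m)

  denominator : ℕ → ℕ → ℕ
  denominator i d = 2 ^ i * i ! * d !

  denominator≢0 : ∀ i d → NonZero (denominator i d)
  denominator≢0 i d = m*n≢0 (2 ^ i * i !) (d !) {{m*n≢0 (2 ^ i) (i !) {{m^n≢0 2 i}} {{i !≢0}}}} {{d !≢0}}

  pairings-closed : ∀ i d → pairings (2 * i + d) i * denominator i d ≡ (2 * i + d) !
  pairings-closed zero    d = trans (+-identityʳ _) (*-identityˡ (d !))
  pairings-closed (suc i) d = subst (λ m → pairings m (suc i) * denominator (suc i) d ≡ m !)
                                    (sym (shift i d)) (step d)
    where
    shift : ∀ i d → 2 * suc i + d ≡ suc (suc (2 * i + d))
    shift = solve-∀
    step : ∀ d → pairings (suc (suc (2 * i + d))) (suc i) * denominator (suc i) d ≡ suc (suc (2 * i + d)) !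
    step zero rewrite pairings-vanish (suc (2 * i + 0)) (suc i) (≤-reflexive (sym (trans (double-suc i) (cong (2 +_) (sym (+-identityʳ (2 * i))))))) = begin
        (0 + suc (2 * i + 0) * pairings (2 * i + 0) i) * (2 * 2 ^ i * (suc i * i !) * 1)
          ≡⟨ regroup (2 * i + 0) (pairings (2 * i + 0) i) (2 ^ i) (i !) i ⟩
        suc (2 * i + 0) * (pairings (2 * i + 0) i * denominator i 0) * (2 * suc i)
          ≡⟨ cong (λ z → suc (2 * i + 0) * z * (2 * suc i)) (pairings-closed i 0) ⟩
        suc (2 * i + 0) * (2 * i + 0) ! * (2 * suc i)
          ≡⟨ factorial i ((2 * i + 0) !) ⟩
        suc (suc (2 * i + 0)) ! ∎
      where
      open ≡-Reasoning
      regroup : ∀ m x p f i → (0 + suc m * x) * (2 * p * (suc i * f) * 1) ≡ suc m * (x * (p * f * 1)) * (2 * suc i)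
      regroup = solve-∀
      factorial : ∀ i F → suc (2 * i + 0) * F * (2 * suc i) ≡ (2 + (2 * i + 0)) * (suc (2 * i + 0) * F)
      factorial = solve-∀
    step (suc d) = begin
        (pairings (suc (2 * i + suc d)) (suc i) + suc (2 * i + suc d) * pairings (2 * i + suc d) i)
          * (2 * 2 ^ i * (suc i * i !) * (suc d * d !))
          ≡⟨ regroup (pairings (suc (2 * i + suc d)) (suc i)) (2 * i + suc d) (pairings (2 * i + suc d) i) (2 ^ i) (i !) i d (d !) ⟩
        pairings (suc (2 * i + suc d)) (suc i) * denominator (suc i) d * suc d
          + suc (2 * i + suc d) * (pairings (2 * i + suc d) i * denominator i (suc d)) * (2 * suc i)
          ≡⟨ cong₂ (λ u v → u * suc d + suc (2 * i + suc d) * v * (2 * suc i)) unpaired (pairings-closed i (suc d)) ⟩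
        suc (2 * i + suc d) ! * suc d + suc (2 * i + suc d) * (2 * i + suc d) ! * (2 * suc i)
          ≡⟨ factorial i d ((2 * i + suc d) !) ⟩
        suc (suc (2 * i + suc d)) ! ∎
      where
      open ≡-Reasoning
      shift′ : ∀ i d → 2 * suc i + d ≡ suc (2 * i + suc d)
      shift′ = solve-∀
      unpaired : pairings (suc (2 * i + suc d)) (suc i) * denominator (suc i) d ≡ suc (2 * i + suc d) !
      unpaired = trans (cong (λ z → pairings z (suc i) * denominator (suc i) d) (sym (shift′ i d)))
                       (trans (pairings-closed (suc i) d) (cong _! (shift′ i d)))
      regroup : ∀ A m x p f i d F → (A + suc m * x) * (2 * p * (suc i * f) * (suc d * F))
         ≡ A * (2 * p * (suc i * f) * F) * suc d + suc m * (x * (p * f * (suc d * F))) * (2 * suc i)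
      regroup = solve-∀
      factorial : ∀ i d F → suc (2 * i + suc d) * F * suc d + suc (2 * i + suc d) * F * (2 * suc i)
          ≡ (2 + (2 * i + suc d)) * (suc (2 * i + suc d) * F)
      factorial = solve-∀

  Σ< : ℕ → (ℕ → ℕ) → ℕ
  Σ< B t = sum (applyUpTo t B)

  Σ<-cong : ∀ B {t u : ℕ → ℕ} → (∀ i → i < B → t i ≡ u i) → Σ< B t ≡ Σ< B u
  Σ<-cong zero    e = refl
  Σ<-cong (suc B) e = cong₂ _+_ (e 0 z<s) (Σ<-cong B (λ i i<B → e (suc i) (s<s i<B)))

  Σ<-snoc : ∀ B t → Σ< (suc B) t ≡ Σ< B t + t B
  Σ<-snoc zero    t = +-comm (t 0) 0
  Σ<-snoc (suc B) t = trans (cong (t 0 +_) (Σ<-snoc B (t ∘ suc))) (sym (+-assoc (t 0) _ _))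

  Σ<-extend : ∀ B e t → (∀ i → B ≤ i → t i ≡ 0) → Σ< (e + B) t ≡ Σ< B t
  Σ<-extend B zero    t _    = refl
  Σ<-extend B (suc e) t vanish = trans (Σ<-snoc (e + B) t)
    (trans (cong₂ _+_ (Σ<-extend B e t vanish) (vanish (e + B) (m≤n+m B e))) (+-identityʳ _))

  Σ<-+ : ∀ B t u → Σ< B (λ i → t i + u i) ≡ Σ< B t + Σ< B u
  Σ<-+ zero    t u = refl
  Σ<-+ (suc B) t u = trans (cong (t 0 + u 0 +_) (Σ<-+ B (t ∘ suc) (u ∘ suc))) (interchange (t 0) (u 0) _ _)
    where
    interchange : ∀ a b c d → a + b + (c + d) ≡ a + c + (b + d)
    interchange = solve-∀

  Σ<-*ˡ : ∀ B c t → Σ< B (λ i → c * t i) ≡ c * Σ< B t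
  Σ<-*ˡ zero    c t = sym (*-zeroʳ c)
  Σ<-*ˡ (suc B) c t = trans (cong (c * t 0 +_) (Σ<-*ˡ B c (t ∘ suc))) (sym (*-distribˡ-+ c (t 0) _))

  summand : ℕ → ℕ → ℕ → ℕ
  summand m k i = (k ^ (m ∸ i) * m !) / (2 ^ i * i ! * (m ∸ 2 * i) !)
    where instance
      _ = m*n≢0 (2 ^ i * i !) ((m ∸ 2 * i) !) {{m*n≢0 (2 ^ i) (i !) {{m^n≢0 2 i}} {{i !≢0}}}} {{(m ∸ 2 * i) !≢0}}

  R-as-Σ< : ∀ m k → R m k ≡ Σ< (suc (m / 2)) (summand m k)
  R-as-Σ< m k = cong sum (map-applyUpTo id _ (suc (m / 2)))

  -- for 2i ≤ m the division in the summand is exact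
  summand-exact : ∀ m k i → 2 * i ≤ m → summand m k i ≡ k ^ (m ∸ i) * pairings m i
  summand-exact m k i 2i≤m = subst (λ m → summand m k i ≡ k ^ (m ∸ i) * pairings m i) (m+[n∸m]≡n 2i≤m)
                                   (exact (m ∸ 2 * i))
    where
    /-cong : ∀ {x x′ y y′} → x ≡ x′ → y ≡ y′ → .{{_ : NonZero y}} .{{_ : NonZero y′}} → x / y ≡ x′ / y′
    /-cong refl refl = refl
    exact : ∀ d → summand (2 * i + d) k i ≡ k ^ (2 * i + d ∸ i) * pairings (2 * i + d) i
    exact d = trans (/-cong (trans (cong (k ^ (2 * i + d ∸ i) *_) (sym (pairings-closed i d)))
                                   (sym (*-assoc (k ^ (2 * i + d ∸ i)) (pairings (2 * i + d) i) (denominator i d))))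
                            (cong (λ z → 2 ^ i * i ! * z !) (m+n∸m≡n (2 * i) d))
                            {{denominator≢0 i (2 * i + d ∸ 2 * i)}} {{denominator≢0 i d}})
                    (m*n/n≡m (k ^ (2 * i + d ∸ i) * pairings (2 * i + d) i) (denominator i d) {{denominator≢0 i d}})

  index-small : ∀ m i → i < suc (m / 2) → 2 * i ≤ m
  index-small m i i≤m/2 = begin
      2 * i       ≤⟨ *-monoʳ-≤ 2 (≤-pred i≤m/2) ⟩
      2 * (m / 2) ≡⟨ *-comm 2 (m / 2) ⟩
      m / 2 * 2   ≤⟨ m/n*n≤m m 2 ⟩
      m           ∎
    where open ≤-Reasoning

  index-large : ∀ m i → suc (m / 2) ≤ i → m < 2 * i
  index-large m i m/2<i = begin-strict
      m                 ≡⟨ m≡m%n+[m/n]*n m 2 ⟩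
      m % 2 + m / 2 * 2 <⟨ +-monoˡ-< (m / 2 * 2) (m%n<n m 2) ⟩
      2 + m / 2 * 2     ≡⟨ twice (m / 2) ⟩
      2 * suc (m / 2)   ≤⟨ *-monoʳ-≤ 2 m/2<i ⟩
      2 * i             ∎
    where
    open ≤-Reasoning
    twice : ∀ x → 2 + x * 2 ≡ 2 * suc x
    twice = solve-∀

  R′ : ℕ → ℕ → ℕ
  R′ m k = Σ< (suc m) (λ i → k ^ (m ∸ i) * pairings m i)

  R≡R′ : ∀ m k → R m k ≡ R′ m k
  R≡R′ m k = begin
      R m k                          ≡⟨ R-as-Σ< m k ⟩
      Σ< (suc (m / 2)) (summand m k) ≡⟨ Σ<-cong (suc (m / 2)) (λ i i≤m/2 → summand-exact m k i (index-small m i i≤m/2)) ⟩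
      Σ< (suc (m / 2)) t             ≡⟨ sym (Σ<-extend (suc (m / 2)) (m ∸ m / 2) t beyond) ⟩
      Σ< (m ∸ m / 2 + suc (m / 2)) t ≡⟨ cong (λ z → Σ< z t) (trans (+-suc (m ∸ m / 2) (m / 2)) (cong suc (m∸n+n≡m (m/n≤m m 2)))) ⟩
      R′ m k                         ∎
    where
    open ≡-Reasoning
    t : ℕ → ℕ
    t i = k ^ (m ∸ i) * pairings m i
    beyond : ∀ i → suc (m / 2) ≤ i → t i ≡ 0
    beyond i m/2<i = trans (cong (k ^ (m ∸ i) *_) (pairings-vanish m i (index-large m i m/2<i))) (*-zeroʳ (k ^ (m ∸ i)))

  Σ<-power-shift : ∀ m k (f : ℕ → ℕ) → f (suc m) ≡ 0 →
    Σ< (suc (suc m)) (λ i → k ^ (suc m ∸ i) * f i) ≡ k * Σ< (suc m) (λ i → k ^ (m ∸ i) * f i)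
  Σ<-power-shift m k f f[m+1]≡0 = begin
      Σ< (suc (suc m)) (λ i → k ^ (suc m ∸ i) * f i)
        ≡⟨ Σ<-snoc (suc m) (λ i → k ^ (suc m ∸ i) * f i) ⟩
      Σ< (suc m) (λ i → k ^ (suc m ∸ i) * f i) + k ^ (suc m ∸ suc m) * f (suc m)
        ≡⟨ cong₂ _+_ (Σ<-cong (suc m) (λ i i≤m → trans (cong (λ z → k ^ z * f i) (+-∸-assoc 1 (≤-pred i≤m)))
                                                        (*-assoc k (k ^ (m ∸ i)) (f i))))
                     (trans (cong (k ^ (suc m ∸ suc m) *_) f[m+1]≡0) (*-zeroʳ (k ^ (suc m ∸ suc m)))) ⟩
      Σ< (suc m) (λ i → k * (k ^ (m ∸ i) * f i)) + 0
        ≡⟨ +-identityʳ _ ⟩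
      Σ< (suc m) (λ i → k * (k ^ (m ∸ i) * f i))
        ≡⟨ Σ<-*ˡ (suc m) k (λ i → k ^ (m ∸ i) * f i) ⟩
      k * Σ< (suc m) (λ i → k ^ (m ∸ i) * f i) ∎
    where open ≡-Reasoning

  R′-recurrence : ∀ m k → R′ (suc (suc m)) k ≡ k * R′ (suc m) k + suc m * k * R′ m k
  R′-recurrence m k = begin
      k ^ (suc (suc m)) * 1 + Σ< (suc (suc m)) (λ i → k ^ (suc m ∸ i) * (pairings (suc m) (suc i) + suc m * pairings m i))
        ≡⟨ cong (k ^ (suc (suc m)) * 1 +_) (trans (Σ<-cong (suc (suc m)) (λ i _ → distrib (k ^ (suc m ∸ i)) (pairings (suc m) (suc i)) (suc m) (pairings m i)))
                                                 (Σ<-+ (suc (suc m)) unpaired paired)) ⟩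
      k ^ (suc (suc m)) * 1 + (Σ< (suc (suc m)) unpaired + Σ< (suc (suc m)) paired)
        ≡⟨ cong₂ (λ u v → k ^ (suc (suc m)) * 1 + (u + v))
             (Σ<-power-shift m k (λ i → pairings (suc m) (suc i)) (pairings-vanish (suc m) (suc (suc m)) (m<2m+4 m)))
             (trans (Σ<-*ˡ (suc (suc m)) (suc m) (λ i → k ^ (suc m ∸ i) * pairings m i))
                    (cong (suc m *_) (Σ<-power-shift m k (pairings m) (pairings-vanish m (suc m) (m<2m+2 m))))) ⟩
      k ^ (suc (suc m)) * 1 + (k * X + suc m * (k * R′ m k))
        ≡⟨ regroup (k ^ (suc m)) k X m (R′ m k) ⟩
      k * (k ^ (suc m) * 1 + X) + suc m * k * R′ m k ∎
    where
    open ≡-Reasoning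
    X : ℕ
    X = Σ< (suc m) (λ i → k ^ (m ∸ i) * pairings (suc m) (suc i))
    unpaired paired : ℕ → ℕ
    unpaired i = k ^ (suc m ∸ i) * pairings (suc m) (suc i)
    paired   i = suc m * (k ^ (suc m ∸ i) * pairings m i)
    distrib : ∀ p x c y → p * (x + c * y) ≡ p * x + c * (p * y)
    distrib = solve-∀
    regroup : ∀ P k X m Y → k * P * 1 + (k * X + suc m * (k * Y)) ≡ k * (P * 1 + X) + suc m * k * Y
    regroup = solve-∀
    m<2m+4 : ∀ m → suc m < 2 * suc (suc m)
    m<2m+4 m = ≤-trans (n<1+n (suc m)) (m≤m+n (suc (suc m)) (suc (suc m) + 0))
    m<2m+2 : ∀ m → m < 2 * suc m
    m<2m+2 m = ≤-trans (n<1+n m) (m≤m+n (suc m) (suc m + 0))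

  R-zero : ∀ k → R 0 k ≡ 1
  R-zero k = R≡R′ 0 k

  R-recurrence : ∀ m k → 1 ≤ m → R m k ≡ k * R (m ∸ 1) k + (m ∸ 1) * k * R (m ∸ 2) k
  R-recurrence (suc zero) k _ = begin
      R 1 k            ≡⟨ R≡R′ 1 k ⟩
      k * 1 * 1 + (1 * 0 + 0) ≡⟨ solve-∀′ k ⟩
      k * 1 + 0 * k * 1     ≡⟨ cong (λ z → k * z + 0 * k * z) (sym (R-zero k)) ⟩
      k * R 0 k + 0 * k * R 0 k ∎
    where
    open ≡-Reasoning
    solve-∀′ : ∀ k → k * 1 * 1 + (1 * 0 + 0) ≡ k * 1 + 0 * k * 1
    solve-∀′ = solve-∀
  R-recurrence (suc (suc m)) k _ = begin
      R (suc (suc m)) k                             ≡⟨ R≡R′ (suc (suc m)) k ⟩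
      R′ (suc (suc m)) k                            ≡⟨ R′-recurrence m k ⟩
      k * R′ (suc m) k + suc m * k * R′ m k          ≡⟨ sym (cong₂ (λ u v → k * u + suc m * k * v) (R≡R′ (suc m) k) (R≡R′ m k)) ⟩
      k * R (suc m) k + suc m * k * R m k            ∎
    where open ≡-Reasoning

module Products where

  open import Data.Nat
  open import Data.Nat.Properties using (≡ᵇ⇒≡; +-identityʳ)
  open import Data.Nat.Tactic.RingSolver using (solve-∀)
  open import Data.Bool using (true; false; T; if_then_else_)
  open import Data.List using (applyUpTo; upTo)
  open import Data.List.Properties using (map-applyUpTo; map-cong)
  open import Data.Nat.ListAction using (product)
  open import Data.Empty using (⊥-elim)
  open import Relation.Nullary using (yes; no)
  open import Relation.Binary.PropositionalEquality
  open import Function using (_∘_; id)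

  _[_≔_] : (ℕ → ℕ) → ℕ → ℕ → ℕ → ℕ
  (g [ k ≔ v ]) i = if i ≡ᵇ k then v else g i

  update-same : ∀ g k v → (g [ k ≔ v ]) k ≡ v
  update-same g zero    v = refl
  update-same g (suc k) v = update-same (g ∘ suc) k v

  update-other : ∀ g k v i → i ≢ k → (g [ k ≔ v ]) i ≡ g i
  update-other g k v i i≢k with i ≡ᵇ k in eq
  ... | true  = ⊥-elim (i≢k (≡ᵇ⇒≡ i k (subst T (sym eq) _)))
  ... | false = refl

  update-update : ∀ g k v w i → ((g [ k ≔ v ]) [ k ≔ w ]) i ≡ (g [ k ≔ w ]) i
  update-update g k v w i with i ≡ᵇ k
  ... | true  = refl
  ... | false = refl

  update-forget : ∀ (F : ℕ → ℕ) (G : ℕ → ℕ) k → (∀ i → i ≢ k → F i ≡ G i) →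
    ∀ i → (F [ k ≔ 1 ]) i ≡ (G [ k ≔ 1 ]) i
  update-forget F G k agree i with i ≟ k
  ... | yes refl = trans (update-same F i 1) (sym (update-same G i 1))
  ... | no  i≢k  = trans (update-other F k 1 i i≢k) (trans (agree i i≢k) (sym (update-other G k 1 i i≢k)))

  private
    product-ones : ∀ n (g : ℕ → ℕ) → (∀ i → i < n → g i ≡ 1) → product (applyUpTo g n) ≡ 1
    product-ones zero    g _    = refl
    product-ones (suc n) g ones = cong₂ _*_ (ones 0 z<s) (product-ones n (g ∘ suc) (λ i i<n → ones (suc i) (s<s i<n)))

    product-factor : ∀ n k (g : ℕ → ℕ) → k < n → product (applyUpTo g n) ≡ g k * product (applyUpTo (g [ k ≔ 1 ]) n)
    product-factor (suc n) zero    g _ = cong (g 0 *_) (sym (+-identityʳ _))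
    product-factor (suc n) (suc k) g (s<s k<n) =
      trans (cong (g 0 *_) (product-factor n k (g ∘ suc) k<n)) (swap (g 0) (g (suc k)) _)
      where
      swap : ∀ a b c → a * (b * c) ≡ b * (a * c)
      swap = solve-∀

  prod1to-cong : ∀ n {F G : ℕ → ℕ} → (∀ i → F i ≡ G i) → prod1to n F ≡ prod1to n G
  prod1to-cong n F≗G = cong product (map-cong (F≗G ∘ suc) (upTo n))

  prod1to-ones : ∀ n (F : ℕ → ℕ) → (∀ i → 1 ≤ i → i ≤ n → F i ≡ 1) → prod1to n F ≡ 1
  prod1to-ones n F ones = trans (cong product (map-applyUpTo id (F ∘ suc) n))
                                (product-ones n (F ∘ suc) (λ i i<n → ones (suc i) (s≤s z≤n) i<n))

  prod1to-factor : ∀ n k (F : ℕ → ℕ) → 1 ≤ k → k ≤ n → prod1to n F ≡ F k * prod1to n (F [ k ≔ 1 ])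
  prod1to-factor n (suc k) F _ k<n = begin
      prod1to n F                                          ≡⟨ cong product (map-applyUpTo id (F ∘ suc) n) ⟩
      product (applyUpTo (F ∘ suc) n)                      ≡⟨ product-factor n k (F ∘ suc) k<n ⟩
      F (suc k) * product (applyUpTo ((F ∘ suc) [ k ≔ 1 ]) n) ≡⟨ cong (F (suc k) *_) (sym (cong product (map-applyUpTo id _ n))) ⟩
      F (suc k) * prod1to n (F [ suc k ≔ 1 ])              ∎
    where open ≡-Reasoning

module Orbits {n : ℕ} (ρ : Permutation′ n) where

  open import Data.Nat hiding (_≟_)
  open import Data.Nat.Properties hiding (_≟_)
  open import Data.Nat.DivMod using (m≡m%n+[m/n]*n; m%n<n)
  open import Data.Fin using (Fin; toℕ; fromℕ<)
  open import Data.Fin.Properties using (toℕ-fromℕ<; toℕ<n; toℕ-injective; pigeonhole; injective⇒≤; any?; _≟_)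
  open import Data.Fin.Permutation using (_⟨$⟩ʳ_; _⟨$⟩ˡ_; inverseˡ; inverseʳ)
  open import Data.Product using (_×_; _,_; proj₁; proj₂; Σ)
  open import Data.Sum using (inj₁; inj₂)
  open import Data.Empty using (⊥-elim)
  open import Relation.Nullary using (Dec; yes; no)
  open import Relation.Nullary.Decidable using (_×-dec_)
  open import Relation.Binary.PropositionalEquality
  open import Relation.Binary.Definitions using (tri<; tri≈; tri>)
  open import Induction.WellFounded using (Acc; acc)
  open import Data.Nat.Induction using (<-wellFounded)

  f f⁻¹ : Fin n → Fin n
  f   x = ρ ⟨$⟩ʳ x
  f⁻¹ x = ρ ⟨$⟩ˡ x

  f⁻¹∘f : ∀ x → f⁻¹ (f x) ≡ x
  f⁻¹∘f x = inverseˡ ρ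

  f∘f⁻¹ : ∀ x → f (f⁻¹ x) ≡ x
  f∘f⁻¹ x = inverseʳ ρ

  it it⁻ : ℕ → Fin n → Fin n
  it  = iter f
  it⁻ = iter f⁻¹

  it-+ : ∀ a b x → it (a + b) x ≡ it a (it b x)
  it-+ zero    b x = refl
  it-+ (suc a) b x = cong f (it-+ a b x)

  it-comm : ∀ a b x → it a (it b x) ≡ it b (it a x)
  it-comm a b x = trans (sym (it-+ a b x)) (trans (cong (λ c → it c x) (+-comm a b)) (it-+ b a x))

  private
    it⁻∘f : ∀ a x → it⁻ a (f x) ≡ f (it⁻ a x)
    it⁻∘f zero    x = refl
    it⁻∘f (suc a) x = trans (cong f⁻¹ (it⁻∘f a x)) (trans (f⁻¹∘f _) (sym (f∘f⁻¹ _)))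

    it∘f⁻¹ : ∀ a x → it a (f⁻¹ x) ≡ f⁻¹ (it a x)
    it∘f⁻¹ zero    x = refl
    it∘f⁻¹ (suc a) x = trans (cong f (it∘f⁻¹ a x)) (trans (f∘f⁻¹ _) (sym (f⁻¹∘f _)))

  it⁻∘it : ∀ a x → it⁻ a (it a x) ≡ x
  it⁻∘it zero    x = refl
  it⁻∘it (suc a) x = trans (cong f⁻¹ (it⁻∘f a (it a x))) (trans (f⁻¹∘f _) (it⁻∘it a x))

  it∘it⁻ : ∀ a x → it a (it⁻ a x) ≡ x
  it∘it⁻ zero    x = refl
  it∘it⁻ (suc a) x = trans (cong f (it∘f⁻¹ a (it⁻ a x))) (trans (f∘f⁻¹ _) (it∘it⁻ a x))

  it-injective : ∀ a {x y} → it a x ≡ it a y → x ≡ y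
  it-injective a {x} {y} e = trans (sym (it⁻∘it a x)) (trans (cong (it⁻ a) e) (it⁻∘it a y))

  it-split : ∀ {a b} → a ≤ b → ∀ x → it b x ≡ it a (it (b ∸ a) x)
  it-split {a} {b} a≤b x = trans (cong (λ c → it c x) (sym (m∸n+n≡m a≤b)))
                                 (trans (it-+ (b ∸ a) a x) (it-comm (b ∸ a) a x))

  Period : Fin n → ℕ → Set
  Period x k = MinPeriod f x k

  period-returns : ∀ {x k} → Period x k → it k x ≡ x
  period-returns (_ , returns , _) = returns

  period-minimal : ∀ {x k} → Period x k → ∀ i → 1 ≤ i → i < k → it i x ≢ x
  period-minimal {x} (_ , _ , minimal) i 1≤i i<k e =
    minimal (fromℕ< i<k) (subst (1 ≤_) (sym (toℕ-fromℕ< i<k)) 1≤i)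
            (subst (λ j → it j x ≡ x) (sym (toℕ-fromℕ< i<k)) e)

  period-unique : ∀ {x k k′} → Period x k → Period x k′ → k ≡ k′
  period-unique {k = k} {k′} p p′ with <-cmp k k′
  ... | tri≈ _ e _ = e
  ... | tri< k<k′ _ _ = ⊥-elim (period-minimal p′ k  (proj₁ p)  k<k′ (period-returns p))
  ... | tri> _ _ k′<k = ⊥-elim (period-minimal p  k′ (proj₁ p′) k′<k (period-returns p′))

  it-mod : ∀ {x k} → Period x (suc k) → ∀ s → it s x ≡ it (s % suc k) x
  it-mod {x} {k} p s = trans (cong (λ c → it c x) (m≡m%n+[m/n]*n s (suc k)))
    (trans (it-+ (s % suc k) (s / suc k * suc k) x) (cong (it (s % suc k)) (multiple (s / suc k))))
    where
    multiple : ∀ q → it (q * suc k) x ≡ x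
    multiple zero    = refl
    multiple (suc q) = trans (it-+ (suc k) (q * suc k) x) (trans (cong (it (suc k)) (multiple q)) (period-returns p))

  period-transfer : ∀ {x y k} → Period x k → Period y k → ∀ c → it c x ≡ x → it c y ≡ y
  period-transfer {k = zero} (() , _) _ _ _
  period-transfer {x} {y} {suc k} px py c e = trans (it-mod py c) (cong (λ r → it r y) c%k≡0)
    where
    c%k≡0 : c % suc k ≡ 0
    c%k≡0 with c % suc k in eq
    ... | zero  = refl
    ... | suc r = ⊥-elim (period-minimal px (suc r) (s≤s z≤n) (subst (_< suc k) eq (m%n<n c (suc k)))
                    (trans (cong (λ j → it j x) (sym eq)) (trans (sym (it-mod px c)) e)))

  private
    relation-transfer≤ : ∀ {x y k} → Period x k → Period y k → ∀ {a b} → a ≤ b → it a x ≡ it b x → it b y ≡ it a y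
    relation-transfer≤ {x} {y} px py {a} {b} a≤b e = trans (it-split a≤b y) (cong (it a)
      (period-transfer px py (b ∸ a) (it-injective a (trans (sym (it-split a≤b x)) (sym e)))))

  relation-transfer : ∀ {x y k} → Period x k → Period y k → ∀ a b → it a x ≡ it b x → it a y ≡ it b y
  relation-transfer px py a b e with ≤-total a b
  ... | inj₁ a≤b = sym (relation-transfer≤ px py a≤b e)
  ... | inj₂ b≤a = relation-transfer≤ px py b≤a (sym e)

  InOrbit : ℕ → Fin n → Fin n → Set
  InOrbit k x0 x = Σ (Fin k) (λ s → it (toℕ s) x0 ≡ x)

  inOrbit? : ∀ k x0 x → Dec (InOrbit k x0 x)
  inOrbit? k x0 x = any? (λ s → it (toℕ s) x0 ≟ x)

  in-orbit : ∀ {x0 k} → Period x0 k → ∀ s → InOrbit k x0 (it s x0)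
  in-orbit {k = zero}     (() , _)
  in-orbit {x0} {suc k} p s = fromℕ< (m%n<n s (suc k)) ,
    trans (cong (λ j → it j x0) (toℕ-fromℕ< (m%n<n s (suc k)))) (sym (it-mod p s))

  f⁻¹-on-orbit : ∀ {x0 k} → Period x0 k → ∀ s → f⁻¹ (it s x0) ≡ it (s + (k ∸ 1)) x0
  f⁻¹-on-orbit {k = zero}     (() , _)
  f⁻¹-on-orbit {x0} {suc k} p s = sym (trans (sym (f⁻¹∘f _)) (cong f⁻¹
    (trans (cong (λ j → it j x0) (sym (+-suc s k))) (trans (it-+ s (suc k) x0) (cong (it s) (period-returns p))))))

  module _ {x0 k} (p : Period x0 k) where

    start-in-orbit : InOrbit k x0 x0
    start-in-orbit = in-orbit p 0

    orbit-f : ∀ {x} → InOrbit k x0 x → InOrbit k x0 (f x)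
    orbit-f (s , refl) = in-orbit p (suc (toℕ s))

    orbit-f⁻¹ : ∀ {x} → InOrbit k x0 x → InOrbit k x0 (f⁻¹ x)
    orbit-f⁻¹ (s , refl) = subst (InOrbit k x0) (sym (f⁻¹-on-orbit p (toℕ s))) (in-orbit p (toℕ s + (k ∸ 1)))

    orbit-f⁻ : ∀ x → InOrbit k x0 (f x) → InOrbit k x0 x
    orbit-f⁻ x c = subst (InOrbit k x0) (f⁻¹∘f x) (orbit-f⁻¹ c)

    orbit-it⁻ : ∀ s {x} → InOrbit k x0 x → InOrbit k x0 (it⁻ s x)
    orbit-it⁻ zero    c = c
    orbit-it⁻ (suc s) c = orbit-f⁻¹ (orbit-it⁻ s c)

    period-in-orbit : ∀ {x} → InOrbit k x0 x → Period x k
    period-in-orbit (s , refl) = proj₁ p , trans (it-comm k (toℕ s) x0) (cong (it (toℕ s)) (period-returns p)) ,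
      λ i 1≤i e → proj₂ (proj₂ p) i 1≤i (it-injective (toℕ s) (trans (it-comm (toℕ s) (toℕ i) x0) e))

    orbit-injective : ∀ (s t : Fin k) → it (toℕ s) x0 ≡ it (toℕ t) x0 → s ≡ t
    orbit-injective s t e with <-cmp (toℕ s) (toℕ t)
    ... | tri≈ _ s≡t _ = toℕ-injective s≡t
    ... | tri< s<t _ _ = ⊥-elim (period-minimal p (toℕ t ∸ toℕ s) (m<n⇒0<n∸m s<t)
            (≤-<-trans (m∸n≤m (toℕ t) (toℕ s)) (toℕ<n t)) (it-injective (toℕ s) (trans (sym (it-split (<⇒≤ s<t) x0)) (sym e))))
    ... | tri> _ _ t<s = ⊥-elim (period-minimal p (toℕ s ∸ toℕ t) (m<n⇒0<n∸m t<s)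
            (≤-<-trans (m∸n≤m (toℕ s) (toℕ t)) (toℕ<n s)) (it-injective (toℕ t) (trans (sym (it-split (<⇒≤ t<s) x0)) e)))

    period≤n : k ≤ n
    period≤n = injective⇒≤ (orbit-injective _ _)

  it⁻-cross : ∀ {a b} s t → it t a ≡ it s b → it⁻ t b ≡ it⁻ s a
  it⁻-cross {a} {b} s t e = it-injective (s + t) (begin
      it (s + t) (it⁻ t b)  ≡⟨ it-+ s t (it⁻ t b) ⟩
      it s (it t (it⁻ t b)) ≡⟨ cong (it s) (it∘it⁻ t b) ⟩
      it s b                ≡⟨ sym e ⟩
      it t a                ≡⟨ cong (it t) (sym (it∘it⁻ s a)) ⟩
      it t (it s (it⁻ s a)) ≡⟨ sym (it-+ t s (it⁻ s a)) ⟩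
      it (t + s) (it⁻ s a)  ≡⟨ cong (λ c → it c (it⁻ s a)) (+-comm t s) ⟩
      it (s + t) (it⁻ s a)  ∎)
    where open ≡-Reasoning

  mirror-involutive : ∀ {a b k} → Period a k → Period b k → (H : Fin n → Fin n) →
    (∀ s → H (it s a) ≡ it⁻ s b) → (∀ s → H (it s b) ≡ it⁻ s a) → ∀ s → H (H (it s a)) ≡ it s a
  mirror-involutive {a} {b} pa pb H a↦b b↦a s with orbit-it⁻ pb s (start-in-orbit pb)
  ... | u , it-u-b≡ = begin
      H (H (it s a))    ≡⟨ cong H (a↦b s) ⟩
      H (it⁻ s b)       ≡⟨ cong H (sym it-u-b≡) ⟩
      H (it (toℕ u) b)  ≡⟨ b↦a (toℕ u) ⟩
      it⁻ (toℕ u) a     ≡⟨ it-injective (toℕ u) (trans (it∘it⁻ (toℕ u) a) (sym back)) ⟩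
      it s a            ∎
    where
    open ≡-Reasoning
    -- f^(s+u) fixes b, hence also a
    back : it (toℕ u) (it s a) ≡ a
    back = trans (it-comm (toℕ u) s a) (trans (sym (it-+ s (toℕ u) a)) (period-transfer pb pa (s + toℕ u)
             (trans (it-+ s (toℕ u) b) (trans (cong (it s) it-u-b≡) (it∘it⁻ s b)))))

  minimal-period : ∀ x → Σ ℕ (Period x)
  minimal-period x with pigeonhole (n<1+n n) (λ (i : Fin (suc n)) → it (toℕ i) x)
  ... | i , j , i<j , e = shrink (toℕ j ∸ toℕ i) (<-wellFounded _) (m<n⇒0<n∸m i<j)
                                 (it-injective (toℕ i) (trans (sym (it-split (<⇒≤ i<j) x)) (sym e)))
    where
    -- descend from any return time to the least one
    shrink : ∀ a → Acc _<_ a → 1 ≤ a → it a x ≡ x → Σ ℕ (Period x)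
    shrink a (acc smaller) 1≤a returns with any? (λ (i : Fin a) → (1 ≤? toℕ i) ×-dec (it (toℕ i) x ≟ x))
    ... | yes (i , 1≤i , e) = shrink (toℕ i) (smaller (toℕ<n i)) 1≤i e
    ... | no  none          = a , 1≤a , returns , λ i 1≤i e → none (i , 1≤i , e)

module Reversal {n : ℕ} (ρ : Permutation′ n) where

  open import Level using (0ℓ)
  open import Data.Nat hiding (_≟_)
  open import Data.Nat.Properties hiding (_≟_)
  open import Data.Fin using (Fin; toℕ)
  open import Data.Fin.Properties using (_≟_; all?; any?)
  open import Data.List using (List; []; _∷_; length; map; allFin)
  open import Data.List.Properties using (length-tabulate; filter-all)
  open import Data.Nat.ListAction using (sum)
  open import Induction.WellFounded using (Acc; acc)
  import Data.List.Relation.Unary.All as All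
  open import Data.List.Relation.Unary.AllPairs using ([]; _∷_)
  open import Data.List.Relation.Unary.Any using (here)
  open import Data.Product using (_×_; _,_; proj₁; proj₂)
  open import Data.Product.Relation.Binary.Pointwise.NonDependent using (_×ₛ_)
  open import Data.Sum using (_⊎_; inj₁; inj₂)
  open import Data.Unit using (⊤; tt)
  open import Data.Empty using (⊥-elim)
  open import Relation.Nullary using (¬_; Dec; yes; no)
  open import Relation.Nullary.Decidable using (_×-dec_; _→-dec_; _⊎-dec_; ¬?; map′)
  open import Relation.Unary using (Pred; Decidable)
  open import Relation.Binary.PropositionalEquality as ≡
  open import Relation.Binary.Bundles using (Setoid)
  open import Function using (_∘_; id)
  open Orbits ρ
  open Counting using (Embedding; count-≡)
  open Enumeration using (Maps; allFin-unique; allFin-complete; allFuns-unique; allFuns-complete; pairs-unique; pairs-complete)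
  open Counts
  open Arithmetic using (R-zero; R-recurrence)
  open Products using (_[_≔_]; update-same; update-other; update-update; update-forget; prod1to-cong; prod1to-factor; prod1to-ones)
  open import Data.Nat.Tactic.RingSolver using (solve-∀)
  open import Data.Nat using () renaming (_≟_ to _≟ℕ_)

  -- a decidable set of points closed under f and f⁻¹, i.e. a union of cycles
  record Region : Set₁ where
    field
      In        : Fin n → Set
      in?       : ∀ x → Dec (In x)
      f-closed  : ∀ {x} → In x → In (f x)
      f⁻-closed : ∀ {x} → In (f x) → In x
  open Region

  it-closed : ∀ S {x} → In S x → ∀ s → In S (it s x)
  it-closed S x∈S zero    = x∈S
  it-closed S x∈S (suc s) = f-closed S (it-closed S x∈S s)

  record Good (S : Region) (g : Fin n → Fin n) : Set where
    constructor good
    field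
      fixes-outside : ∀ x → ¬ In S x → g x ≡ x
      involutive    : ∀ x → g (g x) ≡ x
      reverses      : ∀ x → In S x → g (f x) ≡ f⁻¹ (g x)
  open Good

  good? : ∀ S g → Dec (Good S g)
  good? S g = map′ (λ (o , i , r) → good o i r) (λ (good o i r) → o , i , r)
    (all? (λ x → ¬? (in? S x) →-dec (g x ≟ x)) ×-dec
     (all? (λ x → g (g x) ≟ x) ×-dec all? (λ x → in? S x →-dec (g (f x) ≟ f⁻¹ (g x)))))

  good-resp : ∀ S {g g′} → g ≗ᶠ g′ → Good S g → Good S g′
  good-resp S {g} {g′} g≗g′ gd = good
    (λ x x∉S → trans (sym (g≗g′ x)) (fixes-outside gd x x∉S))
    (λ x → trans (cong g′ (sym (g≗g′ x))) (trans (sym (g≗g′ (g x))) (involutive gd x)))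
    (λ x x∈S → trans (sym (g≗g′ (f x))) (trans (reverses gd x x∈S) (cong f⁻¹ (g≗g′ x))))

  M : Region → ℕ
  M S = count (good? S) (allFuns n)

  fibre : Region → Fin n → Fin n → ℕ
  fibre S x0 y = count (λ g → good? S g ×-dec (g x0 ≟ y)) (allFuns n)

  count-maps : {P Q : Pred (Fin n → Fin n) 0ℓ} (P? : Decidable P) (Q? : Decidable Q) →
    (∀ {g g′} → g ≗ᶠ g′ → P g → P g′) → (∀ {g g′} → g ≗ᶠ g′ → Q g → Q g′) →
    Embedding (Maps n) (Maps n) P Q → Embedding (Maps n) (Maps n) Q P →
    count P? (allFuns n) ≡ count Q? (allFuns n)
  count-maps P? Q? respP respQ = count-≡ (Maps n) (Maps n) P? Q? respP respQ
    (allFuns-unique n) (allFuns-complete n) (allFuns-unique n) (allFuns-complete n)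

  M-empty : ∀ S → (∀ x → ¬ In S x) → M S ≡ 1
  M-empty S empty = count-≡ (Maps n) (≡.setoid ⊤) (good? S) (λ _ → yes tt) (good-resp S) (λ _ q → q)
    (allFuns-unique n) (allFuns-complete n) (All.[] ∷ []) (λ _ → here refl)
    (record { map = λ _ _ → tt ; into = λ _ _ → tt
            ; injective = λ a b p q _ x → trans (fixes-outside p x (empty x)) (sym (fixes-outside q x (empty x))) })
    (record { map = λ _ _ → id ; into = λ _ _ → good (λ _ _ → refl) (λ _ → refl) (λ x x∈S → ⊥-elim (empty x x∈S))
            ; injective = λ _ _ _ _ _ → refl })

  good-on-orbit : ∀ {S g} → Good S g → ∀ {z w} → In S z → g z ≡ w → ∀ s → g (it s z) ≡ it⁻ s w
  good-on-orbit gd z∈S gz≡w zero    = gz≡w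
  good-on-orbit {S} gd z∈S gz≡w (suc s) =
    trans (reverses gd _ (it-closed S z∈S s)) (cong f⁻¹ (good-on-orbit gd z∈S gz≡w s))

  image-period : ∀ {S g x0 k y} → Good S g → In S x0 → Period x0 k → g x0 ≡ y → In S y × Period y k
  image-period {S} {g} {x0} {k} {y} gd x0∈S p gx0≡y = y∈S , proj₁ p , returns , minimal
    where
    gy≡x0 : g y ≡ x0
    gy≡x0 = trans (cong g (sym gx0≡y)) (involutive gd x0)
    y∈S : In S y
    y∈S with in? S y
    ... | yes y∈S = y∈S
    ... | no  y∉S = ⊥-elim (y∉S (subst (In S) (trans (sym gy≡x0) (fixes-outside gd y y∉S)) x0∈S))
    mirror : ∀ s → it⁻ s y ≡ g (it s x0)
    mirror s = sym (good-on-orbit gd x0∈S gx0≡y s)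
    returns : it k y ≡ y
    returns = sym (trans (sym (it∘it⁻ k y)) (cong (it k) (trans (mirror k) (trans (cong g (period-returns p)) gx0≡y))))
    minimal : ∀ i → 1 ≤ toℕ i → it (toℕ i) y ≢ y
    minimal i 1≤i e = proj₂ (proj₂ p) i 1≤i (sym (trans (sym (it∘it⁻ (toℕ i) x0))
      (cong (it (toℕ i)) (trans (sym (good-on-orbit gd y∈S gy≡x0 (toℕ i))) (trans (cong g e) gy≡x0)))))

  -- Let U ⊆ S be a union of cycles, T = S ∖ U, and h a fixed
  -- involution of U reversing f.  The good maps on S that agree with h on U are in
  -- bijection with the good maps on T: forget U (make it fixed), resp. glue h back.
  module Restriction (S T : Region) {U : Fin n → Set} (U? : ∀ x → Dec (U x))
    (T⊆S∖U : ∀ {x} → In T x → In S x × ¬ U x) (S∖U⊆T : ∀ {x} → In S x → ¬ U x → In T x)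
    (U⊆S : ∀ {x} → U x → In S x) (U-f : ∀ {x} → U x → U (f x)) (U-f⁻ : ∀ {x} → U (f x) → U x)
    (h : Fin n → Fin n) (h-into : ∀ {x} → U x → U (h x)) (h-involutive : ∀ {x} → U x → h (h x) ≡ x)
    (h-reverses : ∀ {x} → U x → h (f x) ≡ f⁻¹ (h x)) where

    Extends : (Fin n → Fin n) → Set
    Extends g = Good S g × (∀ x → U x → g x ≡ h x)

    extends? : ∀ g → Dec (Extends g)
    extends? g = good? S g ×-dec all? (λ x → U? x →-dec (g x ≟ h x))

    patch : (Fin n → Fin n) → (Fin n → Fin n) → Fin n → Fin n
    patch p q x with U? x
    ... | yes _ = p x
    ... | no  _ = q x

    patch-in : ∀ p q {x} → U x → patch p q x ≡ p x
    patch-in p q {x} x∈U with U? x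
    ... | yes _   = refl
    ... | no  x∉U = ⊥-elim (x∉U x∈U)

    patch-out : ∀ p q {x} → ¬ U x → patch p q x ≡ q x
    patch-out p q {x} x∉U with U? x
    ... | yes x∈U = ⊥-elim (x∉U x∈U)
    ... | no  _   = refl

    outside-preserved : ∀ {g : Fin n → Fin n} → (∀ x → g (g x) ≡ x) → (∀ {x} → U x → U (g x)) → ∀ {x} → ¬ U x → ¬ U (g x)
    outside-preserved invol preserves x∉U gx∈U = x∉U (subst U (invol _) (preserves gx∈U))

    extension-preserves-U : ∀ {g} → Extends g → ∀ {x} → U x → U (g x)
    extension-preserves-U (_ , agrees) {x} x∈U = subst U (sym (agrees x x∈U)) (h-into x∈U)

    restrict-good : ∀ g → Extends g → Good T (patch id g)
    restrict-good g e@(gd , _) = good outside invol rev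
      where
      g-out : ∀ {x} → ¬ U x → ¬ U (g x)
      g-out = outside-preserved (involutive gd) (extension-preserves-U e)
      outside : ∀ x → ¬ In T x → patch id g x ≡ x
      outside x x∉T with U? x
      ... | yes _   = refl
      ... | no  x∉U = fixes-outside gd x (λ x∈S → x∉T (S∖U⊆T x∈S x∉U))
      invol : ∀ x → patch id g (patch id g x) ≡ x
      invol x with U? x
      ... | yes x∈U = patch-in id g x∈U
      ... | no  x∉U = trans (patch-out id g (g-out x∉U)) (involutive gd x)
      rev : ∀ x → In T x → patch id g (f x) ≡ f⁻¹ (patch id g x)
      rev x x∈T = let (x∈S , x∉U) = T⊆S∖U x∈T in
        trans (patch-out id g (x∉U ∘ U-f⁻)) (trans (reverses gd x x∈S) (cong f⁻¹ (sym (patch-out id g x∉U))))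

    restrict-injective : ∀ a b → Extends a → Extends b → patch id a ≗ᶠ patch id b → a ≗ᶠ b
    restrict-injective a b (_ , a≡h) (_ , b≡h) e x with U? x
    ... | yes x∈U = trans (a≡h x x∈U) (sym (b≡h x x∈U))
    ... | no  x∉U = trans (sym (patch-out id a x∉U)) (trans (e x) (patch-out id b x∉U))

    extend-extends : ∀ g → Good T g → Extends (patch h g)
    extend-extends g gd = good outside invol rev , λ x → patch-in h g
      where
      -- g fixes U pointwise, hence preserves its complement
      g-out : ∀ {x} → ¬ U x → ¬ U (g x)
      g-out = outside-preserved (involutive gd) (λ {x} x∈U → subst U (sym (fixes-outside gd x (λ x∈T → proj₂ (T⊆S∖U x∈T) x∈U))) x∈U)
      outside : ∀ x → ¬ In S x → patch h g x ≡ x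
      outside x x∉S = trans (patch-out h g (x∉S ∘ U⊆S)) (fixes-outside gd x (x∉S ∘ proj₁ ∘ T⊆S∖U))
      invol : ∀ x → patch h g (patch h g x) ≡ x
      invol x with U? x
      ... | yes x∈U = trans (patch-in h g (h-into x∈U)) (h-involutive x∈U)
      ... | no  x∉U = trans (patch-out h g (g-out x∉U)) (involutive gd x)
      rev : ∀ x → In S x → patch h g (f x) ≡ f⁻¹ (patch h g x)
      rev x x∈S with U? x
      ... | yes x∈U = trans (patch-in h g (U-f x∈U)) (h-reverses x∈U)
      ... | no  x∉U = trans (patch-out h g (x∉U ∘ U-f⁻)) (reverses gd x (S∖U⊆T x∈S x∉U))

    extend-injective : ∀ a b → Good T a → Good T b → patch h a ≗ᶠ patch h b → a ≗ᶠ b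
    extend-injective a b ga gb e x with U? x
    ... | yes x∈U = trans (fixes-outside ga x x∉T) (sym (fixes-outside gb x x∉T))
      where
      x∉T : ¬ In T x
      x∉T x∈T = proj₂ (T⊆S∖U x∈T) x∈U
    ... | no  x∉U = trans (sym (patch-out h a x∉U)) (trans (e x) (patch-out h b x∉U))

    count-extensions : count extends? (allFuns n) ≡ M T
    count-extensions = count-maps extends? (good? T)
      (λ g≗g′ (gd , agrees) → good-resp S g≗g′ gd , λ x x∈U → trans (sym (g≗g′ x)) (agrees x x∈U))
      (good-resp T)
      (record { map = λ g _ → patch id g ; into = restrict-good ; injective = restrict-injective })
      (record { map = λ g _ → patch h g  ; into = extend-extends ; injective = extend-injective })

  -- For x0, y of the same period k, a good map g with g x0 = y is
  -- forced on U = orbit(x0) ∪ orbit(y):  g(f^s x0) = f^(-s) y,  g(f^s y) = f^(-s) x0.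
  -- This prescribed map `reflect` is an f-reversing involution of U, so the good
  -- maps with x0 ↦ y are counted by `Restriction` applied to U.
  module Reflection {x0 y k} (px0 : Period x0 k) (py : Period y k) where

    U : Fin n → Set
    U x = InOrbit k x0 x ⊎ InOrbit k y x

    U? : ∀ x → Dec (U x)
    U? x = inOrbit? k x0 x ⊎-dec inOrbit? k y x

    reflect : Fin n → Fin n
    reflect x with inOrbit? k x0 x | inOrbit? k y x
    ... | yes (s , _) | _           = it⁻ (toℕ s) y
    ... | no  _       | yes (s , _) = it⁻ (toℕ s) x0
    ... | no  _       | no  _       = x

    reflect-x0 : ∀ s → reflect (it s x0) ≡ it⁻ s y
    reflect-x0 s with inOrbit? k x0 (it s x0) | inOrbit? k y (it s x0)
    ... | yes (t , e) | _ = it⁻-cross s (toℕ t) (relation-transfer px0 py (toℕ t) s e)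
    ... | no  x∉C     | _ = ⊥-elim (x∉C (in-orbit px0 s))

    reflect-y : ∀ s → reflect (it s y) ≡ it⁻ s x0
    reflect-y s with inOrbit? k x0 (it s y) | inOrbit? k y (it s y)
    ... | yes (t , e) | _           = it⁻-cross s (toℕ t) e
    ... | no  _       | yes (t , e) = it⁻-cross s (toℕ t) (relation-transfer py px0 (toℕ t) s e)
    ... | no  _       | no  x∉D     = ⊥-elim (x∉D (in-orbit py s))

    U-f : ∀ {x} → U x → U (f x)
    U-f (inj₁ c) = inj₁ (orbit-f px0 c)
    U-f (inj₂ d) = inj₂ (orbit-f py d)

    U-f⁻ : ∀ {x} → U (f x) → U x
    U-f⁻ (inj₁ c) = inj₁ (orbit-f⁻ px0 _ c)
    U-f⁻ (inj₂ d) = inj₂ (orbit-f⁻ py _ d)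

    reflect-into : ∀ {x} → U x → U (reflect x)
    reflect-into (inj₁ (s , refl)) = inj₂ (subst (InOrbit k y) (sym (reflect-x0 (toℕ s))) (orbit-it⁻ py (toℕ s) (start-in-orbit py)))
    reflect-into (inj₂ (s , refl)) = inj₁ (subst (InOrbit k x0) (sym (reflect-y (toℕ s))) (orbit-it⁻ px0 (toℕ s) (start-in-orbit px0)))

    reflect-involutive : ∀ {x} → U x → reflect (reflect x) ≡ x
    reflect-involutive (inj₁ (s , refl)) = mirror-involutive px0 py reflect reflect-x0 reflect-y (toℕ s)
    reflect-involutive (inj₂ (s , refl)) = mirror-involutive py px0 reflect reflect-y reflect-x0 (toℕ s)

    reflect-reverses : ∀ {x} → U x → reflect (f x) ≡ f⁻¹ (reflect x)
    reflect-reverses (inj₁ (s , refl)) = trans (reflect-x0 (suc (toℕ s))) (cong f⁻¹ (sym (reflect-x0 (toℕ s))))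
    reflect-reverses (inj₂ (s , refl)) = trans (reflect-y (suc (toℕ s))) (cong f⁻¹ (sym (reflect-y (toℕ s))))

    reflect-forced : ∀ {S g} → Good S g → In S x0 → In S y → g x0 ≡ y → ∀ x → U x → g x ≡ reflect x
    reflect-forced gd x0∈S _   gx0≡y _ (inj₁ (s , refl)) =
      trans (good-on-orbit gd x0∈S gx0≡y (toℕ s)) (sym (reflect-x0 (toℕ s)))
    reflect-forced gd x0∈S y∈S gx0≡y _ (inj₂ (s , refl)) =
      trans (good-on-orbit gd y∈S (trans (cong _ (sym gx0≡y)) (involutive gd x0)) (toℕ s)) (sym (reflect-y (toℕ s)))

    fibre-count : ∀ S T → In S x0 → In S y →
      (∀ {x} → In T x → In S x × ¬ U x) → (∀ {x} → In S x → ¬ U x → In T x) →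
      fibre S x0 y ≡ M T
    fibre-count S T x0∈S y∈S T⊆S∖U S∖U⊆T = trans
      (count-≐ _ extends? (λ (gd , gx0≡y) → gd , reflect-forced gd x0∈S y∈S gx0≡y)
                          (λ (gd , agrees) → gd , trans (agrees x0 (inj₁ (start-in-orbit px0))) (reflect-x0 0))
                          (allFuns n))
      count-extensions
      where
      U⊆S : ∀ {x} → U x → In S x
      U⊆S (inj₁ (s , refl)) = it-closed S x0∈S (toℕ s)
      U⊆S (inj₂ (s , refl)) = it-closed S y∈S (toℕ s)
      open Restriction S T U? T⊆S∖U S∖U⊆T U⊆S U-f U-f⁻ reflect reflect-into reflect-involutive reflect-reverses

  remove : Region → ∀ {x0 k} → Period x0 k → Region
  remove S {x0} {k} p = record
    { In        = λ x → In S x × ¬ InOrbit k x0 x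
    ; in?       = λ x → in? S x ×-dec ¬? (inOrbit? k x0 x)
    ; f-closed  = λ (x∈S , x∉C) → f-closed S x∈S , x∉C ∘ orbit-f⁻ p _
    ; f⁻-closed = λ (fx∈S , fx∉C) → f⁻-closed S fx∈S , fx∉C ∘ orbit-f p
    }

  size : Region → ℕ
  size S = count (in? S) (allFin n)

  points : Region → ℕ → ℕ
  points S k = count (λ x → in? S x ×-dec minPeriod? f x k) (allFin n)

  orbit-size : ∀ {x0 k} → Period x0 k → count (inOrbit? k x0) (allFin n) ≡ k
  orbit-size {x0} {k} p = sym (begin
      k                                   ≡⟨ sym (length-tabulate {n = k} id) ⟩
      length (allFin k)                   ≡⟨ cong length (sym (filter-all (λ _ → yes tt) (All.universal (λ _ → tt) (allFin k)))) ⟩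
      count (λ _ → yes tt) (allFin k)     ≡⟨ count-≡ (≡.setoid (Fin k)) (≡.setoid (Fin n)) (λ _ → yes tt) (inOrbit? k x0)
                                               (λ _ _ → tt) (λ { refl c → c })
                                               (allFin-unique k) (allFin-complete k) (allFin-unique n) (allFin-complete n)
                                               (record { map = λ s _ → it (toℕ s) x0 ; into = λ s _ → s , refl
                                                       ; injective = λ s t _ _ → orbit-injective p s t })
                                               (record { map = λ _ c → proj₁ c ; into = λ _ _ → tt
                                                       ; injective = λ { _ _ (s , refl) (t , refl) refl → refl } }) ⟩
      count (inOrbit? k x0) (allFin n)    ∎)
    where open ≡-Reasoning

  module Removal (S : Region) {x0 k} (x0∈S : In S x0) (p : Period x0 k) where

    S′ : Region
    S′ = remove S p

    on-cycle : ℕ → ℕ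
    on-cycle k′ = count (λ x → (in? S x ×-dec minPeriod? f x k′) ×-dec inOrbit? k x0 x) (allFin n)

    points-split : ∀ k′ → points S k′ ≡ on-cycle k′ + points S′ k′
    points-split k′ = trans (count-split (λ x → in? S x ×-dec minPeriod? f x k′) (inOrbit? k x0) (allFin n))
      (cong (on-cycle k′ +_) (count-≐ _ _ (λ ((x∈S , q) , x∉C) → (x∈S , x∉C) , q)
                                          (λ ((x∈S , x∉C) , q) → (x∈S , q) , x∉C) (allFin n)))

    smaller : size S′ < size S
    smaller = begin-strict
      size S′                                       ≡⟨ count-≐ (in? S′) _ id id (allFin n) ⟩
      count (λ x → in? S x ×-dec ¬? (inOrbit? k x0 x)) (allFin n)
        <⟨ m<n+m _ (count-some _ (allFin n) (allFin-complete n x0) (x0∈S , start-in-orbit p)) ⟩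
      count (λ x → in? S x ×-dec inOrbit? k x0 x) (allFin n) + count (λ x → in? S x ×-dec ¬? (inOrbit? k x0 x)) (allFin n)
                                                    ≡⟨ sym (count-split (in? S) (inOrbit? k x0) (allFin n)) ⟩
      size S                                        ∎
      where open ≤-Reasoning

    points-same : points S k ≡ k + points S′ k
    points-same = trans (points-split k) (cong (_+ points S′ k) (trans
      (count-≐ _ (inOrbit? k x0) proj₂ (λ c → (it-closed′ c , period-in-orbit p c) , c) (allFin n)) (orbit-size p)))
      where
      it-closed′ : ∀ {x} → InOrbit k x0 x → In S x
      it-closed′ (s , refl) = it-closed S x0∈S (toℕ s)

    points-other : ∀ k′ → k′ ≢ k → points S k′ ≡ points S′ k′
    points-other k′ k′≢k = trans (points-split k′) (cong (_+ points S′ k′)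
      (count-none _ (λ x ((_ , q) , c) → k′≢k (period-unique q (period-in-orbit p c))) (allFin n)))

  -- `j k` is the number of k-cycles of ρ inside S
  CycleCounts : Region → (ℕ → ℕ) → Set
  CycleCounts S j = ∀ k → 1 ≤ k → k ≤ n → points S k ≡ k * j k

  Prod : (ℕ → ℕ) → ℕ
  Prod j = prod1to n (λ i → R (j i) i)

  Rest : (ℕ → ℕ) → ℕ → ℕ
  Rest j k = prod1to n ((λ i → R (j i) i) [ k ≔ 1 ])

  Prod-factor : ∀ j k → 1 ≤ k → k ≤ n → Prod j ≡ R (j k) k * Rest j k
  Prod-factor j k 1≤k k≤n = prod1to-factor n k (λ i → R (j i) i) 1≤k k≤n

  Prod-update : ∀ j k v → 1 ≤ k → k ≤ n → Prod (j [ k ≔ v ]) ≡ R v k * Rest j k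
  Prod-update j k v 1≤k k≤n = trans (Prod-factor (j [ k ≔ v ]) k 1≤k k≤n) (cong₂ _*_
    (cong (λ m → R m k) (update-same j k v))
    (prod1to-cong n (update-forget _ _ k (λ i i≢k → cong (λ m → R m i) (update-other j k v i i≢k)))))

  counts-cong : ∀ S {j j′} → (∀ i → j i ≡ j′ i) → CycleCounts S j → CycleCounts S j′
  counts-cong S j≗j′ counts i 1≤i i≤n = trans (counts i 1≤i i≤n) (cong (i *_) (j≗j′ i))

  counts-remove : ∀ S {x0 k} (x0∈S : In S x0) (p : Period x0 k) j → CycleCounts S j →
    CycleCounts (remove S p) (j [ k ≔ j k ∸ 1 ])
  counts-remove S {x0} {k} x0∈S p j counts i 1≤i i≤n with i ≟ℕ k
  ... | yes refl = begin
      points S′ i         ≡⟨ sym (m+n∸m≡n i (points S′ i)) ⟩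
      i + points S′ i ∸ i ≡⟨ cong (_∸ i) (trans (sym points-same) (counts i 1≤i i≤n)) ⟩
      i * j i ∸ i         ≡⟨ cong (i * j i ∸_) (sym (*-identityʳ i)) ⟩
      i * j i ∸ i * 1     ≡⟨ sym (*-distribˡ-∸ i (j i) 1) ⟩
      i * (j i ∸ 1)       ≡⟨ cong (i *_) (sym (update-same j i (j i ∸ 1))) ⟩
      i * (j [ i ≔ j i ∸ 1 ]) i ∎
    where
    open ≡-Reasoning
    open Removal S x0∈S p
  ... | no i≢k = trans (sym (points-other i i≢k)) (trans (counts i 1≤i i≤n)
                   (cong (i *_) (sym (update-other j k (j k ∸ 1) i i≢k))))
    where open Removal S x0∈S p

  -- a region without points contains no cycles, and every factor of Prod is R 0 i = 1
  Prod-empty : ∀ S j → (∀ x → ¬ In S x) → CycleCounts S j → Prod j ≡ 1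
  Prod-empty S j empty counts = prod1to-ones n _ no-cycles
    where
    no-cycles : ∀ i → 1 ≤ i → i ≤ n → R (j i) i ≡ 1
    no-cycles i 1≤i i≤n with m*n≡0⇒m≡0∨n≡0 i (trans (sym (counts i 1≤i i≤n)) (count-none _ (λ x → empty x ∘ proj₁) (allFin n)))
    ... | inj₁ refl = ⊥-elim (1≰0 1≤i)
      where
      1≰0 : ¬ 1 ≤ 0
      1≰0 ()
    ... | inj₂ jᵢ≡0 = trans (cong (λ m → R m i) jᵢ≡0) (R-zero i)

  -- One step of the recursion: pick x0 ∈ S of period k and classify the good maps
  -- g by y = g x0.  Either y lies on the cycle of x0 (k choices, the rest of g is
  -- good on S ∖ cycle(x0)), or on another k-cycle of S (k (m-1) choices, the rest is
  -- good on S minus both cycles); any other y is impossible.  Hence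
  --   M S = k · Prod j₁ + k (m-1) · Prod j₂ = Prod j     (m = j k)
  -- by the recurrence for R, assuming the formula for smaller regions.
  module Step (S : Region) {x0 k} (x0∈S : In S x0) (p : Period x0 k) (j : ℕ → ℕ) (counts : CycleCounts S j)
    (ih : ∀ T → size T < size S → ∀ j′ → CycleCounts T j′ → M T ≡ Prod j′) where

    open Removal S x0∈S p

    m : ℕ
    m = j k

    1≤k : 1 ≤ k
    1≤k = proj₁ p

    k≤n : k ≤ n
    k≤n = period≤n p

    -- the cycle of x0 is one of the m cycles of length k
    1≤m : 1 ≤ m
    1≤m with m | counts k 1≤k k≤n
    ... | zero  | k*0≡ = ⊥-elim (<⇒≱ 1≤k (≤-trans (m≤m+n k (points S′ k)) (≤-reflexive (trans (sym points-same) (trans k*0≡ (*-zeroʳ k))))))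
    ... | suc _ | _    = s≤s z≤n

    j₁ j₂ : ℕ → ℕ
    j₁ = j [ k ≔ m ∸ 1 ]
    j₂ = j [ k ≔ m ∸ 2 ]

    counts₁ : CycleCounts S′ j₁
    counts₁ = counts-remove S x0∈S p j counts

    other? : ∀ y → Dec (In S′ y × Period y k)
    other? y = in? S′ y ×-dec minPeriod? f y k

    -- y ∈ C: g is forced on C and good on S′ elsewhere
    fibre-own : ∀ {y} → InOrbit k x0 y → fibre S x0 y ≡ Prod j₁
    fibre-own {y} c@(s , refl) = trans (fibre-count S S′ x0∈S (it-closed S x0∈S (toℕ s)) S′⊆S∖U S∖U⊆S′) (ih S′ smaller j₁ counts₁)
      where
      open Reflection p (period-in-orbit p c)
      same-cycle : ∀ {x} → InOrbit k y x → InOrbit k x0 x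
      same-cycle (t , refl) = subst (InOrbit k x0) (it-+ (toℕ t) (toℕ s) x0) (in-orbit p (toℕ t + toℕ s))
      S′⊆S∖U : ∀ {x} → In S′ x → In S x × ¬ U x
      S′⊆S∖U (x∈S , x∉C) = x∈S , λ { (inj₁ x∈C) → x∉C x∈C ; (inj₂ x∈D) → x∉C (same-cycle x∈D) }
      S∖U⊆S′ : ∀ {x} → In S x → ¬ U x → In S′ x
      S∖U⊆S′ x∈S x∉U = x∈S , x∉U ∘ inj₁

    -- y on another k-cycle D: g swaps C and D and is good on S′ ∖ D elsewhere
    fibre-other : ∀ {y} → In S′ y → (py : Period y k) → fibre S x0 y ≡ Prod j₂
    fibre-other {y} y∈S′ py = trans (fibre-count S S″ x0∈S (proj₁ y∈S′) S″⊆S∖U S∖U⊆S″)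
                                    (ih S″ (<-trans Second.smaller smaller) j₂ counts₂)
      where
      open Reflection p py
      module Second = Removal S′ y∈S′ py
      S″ : Region
      S″ = remove S′ py
      S″⊆S∖U : ∀ {x} → In S″ x → In S x × ¬ U x
      S″⊆S∖U ((x∈S , x∉C) , x∉D) = x∈S , λ { (inj₁ x∈C) → x∉C x∈C ; (inj₂ x∈D) → x∉D x∈D }
      S∖U⊆S″ : ∀ {x} → In S x → ¬ U x → In S″ x
      S∖U⊆S″ x∈S x∉U = (x∈S , x∉U ∘ inj₁) , x∉U ∘ inj₂
      counts₂ : CycleCounts S″ j₂
      counts₂ = counts-cong S″ (λ i → trans (update-update j k (m ∸ 1) _ i)
                  (cong (λ v → (j [ k ≔ v ]) i) (trans (cong (_∸ 1) (update-same j k (m ∸ 1))) (∸-+-assoc m 1 1))))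
                (counts-remove S′ y∈S′ py j₁ counts₁)

    -- otherwise no good map sends x0 to y, since y would have period k in S
    fibre-none : ∀ {y} → ¬ InOrbit k x0 y → ¬ (In S′ y × Period y k) → fibre S x0 y ≡ 0
    fibre-none y∉C not-other = count-none _ (λ g (gd , gx0≡y) →
      let (y∈S , py) = image-period gd x0∈S p gx0≡y in not-other ((y∈S , y∉C) , py)) (allFuns n)

    fibre-value : ∀ y → fibre S x0 y ≡ 𝟙 (inOrbit? k x0 y) * Prod j₁ + 𝟙 (other? y) * Prod j₂
    fibre-value y = by-cases (inOrbit? k x0 y) (other? y)
      where
      by-cases : (own : Dec (InOrbit k x0 y)) (other : Dec (In S′ y × Period y k)) →
        fibre S x0 y ≡ 𝟙 own * Prod j₁ + 𝟙 other * Prod j₂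
      by-cases (yes y∈C) (yes ((_ , y∉C) , _)) = ⊥-elim (y∉C y∈C)
      by-cases (yes y∈C) (no  _)               = trans (fibre-own y∈C) (sym (trans (+-identityʳ _) (+-identityʳ _)))
      by-cases (no  _)   (yes (y∈S′ , py))     = trans (fibre-other y∈S′ py) (sym (+-identityʳ _))
      by-cases (no  y∉C) (no  not-other)       = fibre-none y∉C not-other

    M-by-fibres : M S ≡ k * Prod j₁ + k * (m ∸ 1) * Prod j₂
    M-by-fibres = begin
      M S
        ≡⟨ count-by-fibres (good? S) (λ g → g x0) (allFuns n) ⟩
      sum (map (fibre S x0) (allFin n))
        ≡⟨ sum-cong fibre-value (allFin n) ⟩
      sum (map (λ y → 𝟙 (inOrbit? k x0 y) * Prod j₁ + 𝟙 (other? y) * Prod j₂) (allFin n))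
        ≡⟨ sum-+ (λ y → 𝟙 (inOrbit? k x0 y) * Prod j₁) (λ y → 𝟙 (other? y) * Prod j₂) (allFin n) ⟩
      sum (map (λ y → 𝟙 (inOrbit? k x0 y) * Prod j₁) (allFin n)) + sum (map (λ y → 𝟙 (other? y) * Prod j₂) (allFin n))
        ≡⟨ cong₂ _+_ (sum-*ʳ (Prod j₁) (λ y → 𝟙 (inOrbit? k x0 y)) (allFin n)) (sum-*ʳ (Prod j₂) (λ y → 𝟙 (other? y)) (allFin n)) ⟩
      sum (map (λ y → 𝟙 (inOrbit? k x0 y)) (allFin n)) * Prod j₁ + sum (map (λ y → 𝟙 (other? y)) (allFin n)) * Prod j₂
        ≡⟨ cong₂ (λ a b → a * Prod j₁ + b * Prod j₂) (trans (sum-𝟙 (inOrbit? k x0) (allFin n)) (orbit-size p))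
             (trans (sum-𝟙 other? (allFin n)) (trans (counts₁ k 1≤k k≤n) (cong (k *_) (update-same j k (m ∸ 1))))) ⟩
      k * Prod j₁ + k * (m ∸ 1) * Prod j₂ ∎
      where open ≡-Reasoning

    M-step : M S ≡ Prod j
    M-step = begin
      M S                                                              ≡⟨ M-by-fibres ⟩
      k * Prod j₁ + k * (m ∸ 1) * Prod j₂                               ≡⟨ cong₂ (λ a b → k * a + k * (m ∸ 1) * b)
                                                                            (Prod-update j k (m ∸ 1) 1≤k k≤n) (Prod-update j k (m ∸ 2) 1≤k k≤n) ⟩
      k * (R (m ∸ 1) k * Rest j k) + k * (m ∸ 1) * (R (m ∸ 2) k * Rest j k) ≡⟨ factor-out k (R (m ∸ 1) k) (R (m ∸ 2) k) (m ∸ 1) (Rest j k) ⟩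
      (k * R (m ∸ 1) k + (m ∸ 1) * k * R (m ∸ 2) k) * Rest j k          ≡⟨ cong (_* Rest j k) (sym (R-recurrence m k 1≤m)) ⟩
      R m k * Rest j k                                                 ≡⟨ sym (Prod-factor j k 1≤k k≤n) ⟩
      Prod j                                                           ∎
      where
      open ≡-Reasoning
      factor-out : ∀ k a b c r → k * (a * r) + k * c * (b * r) ≡ (k * a + c * k * b) * r
      factor-out = solve-∀

  M-formula : ∀ S → Acc _<_ (size S) → ∀ j → CycleCounts S j → M S ≡ Prod j
  M-formula S (acc smaller) j counts with any? (in? S)
  ... | no  empty       = trans (M-empty S λ x x∈S → empty (x , x∈S)) (sym (Prod-empty S j (λ x x∈S → empty (x , x∈S)) counts))
  ... | yes (x0 , x0∈S) = Step.M-step S x0∈S (proj₂ (minimal-period x0)) j counts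
                            (λ T T<S → M-formula T (smaller T<S))

  whole : Region
  whole = record { In = λ _ → ⊤ ; in? = λ _ → yes tt ; f-closed = λ _ → tt ; f⁻-closed = λ _ → tt }

  -- (σ , τ) ↦ σ is a bijection from the pairs counted by N onto the good maps on
  -- all of [n]; its inverse is σ ↦ (σ , σ ∘ f), since τ = σ⁻¹ ρ = σ ∘ f.
  N≡M : N ρ ≡ M whole
  N≡M = count-≡ (Maps n ×ₛ Maps n) (Maps n) (invPair? ρ) (good? whole) pair-resp (good-resp whole)
    (pairs-unique n) (pairs-complete n) (allFuns-unique n) (allFuns-complete n)
    (record { map = λ (σ , _) _ → σ ; into = λ _ → first-good ; injective = first-injective })
    (record { map = λ σ _ → σ , σ ∘ f ; into = λ _ → pair-of-good ; injective = λ _ _ _ _ → proj₁ })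
    where
    pair-resp : ∀ {a b} → Setoid._≈_ (Maps n ×ₛ Maps n) a b → InvPair ρ a → InvPair ρ b
    pair-resp {σ , τ} {σ′ , τ′} (σ≗ , τ≗) (σσ , ττ , στ) =
      (λ x → trans (cong σ′ (sym (σ≗ x))) (trans (sym (σ≗ (σ x))) (σσ x))) ,
      (λ x → trans (cong τ′ (sym (τ≗ x))) (trans (sym (τ≗ (τ x))) (ττ x))) ,
      (λ x → trans (cong σ′ (sym (τ≗ x))) (trans (sym (σ≗ (τ x))) (στ x)))
    τ≡σ∘f : ∀ {σ τ : Fin n → Fin n} → InvPair ρ (σ , τ) → ∀ z → τ z ≡ σ (f z)
    τ≡σ∘f {σ} (σσ , _ , στ) z = trans (sym (σσ _)) (cong σ (στ z))
    first-good : ∀ {σ τ} → InvPair ρ (σ , τ) → Good whole σ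
    first-good {σ} {τ} pair@(σσ , ττ , _) = good (λ _ x∉ → ⊥-elim (x∉ tt)) σσ (λ x _ → reverses-f x)
      where
      reverses-f : ∀ x → σ (f x) ≡ f⁻¹ (σ x)
      reverses-f x = trans (sym (f⁻¹∘f _)) (cong f⁻¹ (trans (sym (σσ _))
        (cong σ (trans (sym (τ≡σ∘f {σ} {τ} pair (σ (f x)))) (trans (cong τ (sym (τ≡σ∘f {σ} {τ} pair x))) (ττ x))))))
    first-injective : ∀ a b → InvPair ρ a → InvPair ρ b → proj₁ a ≗ᶠ proj₁ b → Setoid._≈_ (Maps n ×ₛ Maps n) a b
    first-injective (σ , τ) (σ′ , τ′) pair pair′ σ≗σ′ =
      σ≗σ′ , λ z → trans (τ≡σ∘f {σ} {τ} pair z) (trans (σ≗σ′ (f z)) (sym (τ≡σ∘f {σ′} {τ′} pair′ z)))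
    pair-of-good : ∀ {σ} → Good whole σ → InvPair ρ (σ , σ ∘ f)
    pair-of-good gd = involutive gd ,
      (λ x → trans (reverses gd _ tt) (trans (cong f⁻¹ (involutive gd (f x))) (f⁻¹∘f x))) ,
      (λ x → involutive gd (f x))

  counts-whole : ∀ j → HasCycleType ρ j → CycleCounts whole j
  counts-whole j cycle-type k 1≤k k≤n =
    trans (count-≐ _ _ proj₂ (tt ,_) (allFin n)) (cycle-type k 1≤k k≤n)

theorem2p1 : (n : ℕ) → 1 ≤ n → (j : ℕ → ℕ) → sum1to n (λ i → i * j i) ≡ n →
    (ρ : Permutation′ n) → HasCycleType ρ j →
    N ρ ≡ prod1to n (λ i → R (j i) i)
theorem2p1 n _ j _ ρ cycle-type = begin
    N ρ        ≡⟨ N≡M ⟩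
    M whole    ≡⟨ M-formula whole (<-wellFounded _) j (counts-whole j cycle-type) ⟩
    Prod j     ∎
  where
  open Reversal ρ
  open ≡-Reasoning
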